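{- Let $M=M[\mathcal{I}]$ be a multi-path matroid of rank $r$ and nullity $m$ on $[m+r]$, presented by an antichain $\mathcal{I}$ of $\sigma$-intervals where $\sigma=(1,2,\ldots,m+r)$, and let $D=D(\mathcal{I},1)$ with points $p_1,\ldots,p_k$, $p'_1,\ldots,p'_k$, bottom border $P$ and top border $Q$. Let $B$ be a basis of $M$ and let $\Pi(B,p_i)$ be a valid path. Activities are taken with respect to the order $1<2<\cdots<m+r$. (I) An element $u\in B$ is internally active if and only if either (a) $\{1,\ldots,u\}\subseteq B$, or (b) the $u$-th step of $\Pi(B,p_i)$ lies in $Q$ and $(u,m+r]\Pi(B,p_i)$ touches $P$. (II) An element $u\notin B$ is externally active if and only if either (a) $\{1,\ldots,u\}\cap B=\emptyset$, or (b) the $u$-th step of $\Pi(B,p_i)$ lies in $P$ and $(u,m+r]\Pi(B,p_i)$ touches $Q$.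
   Context: Transversal matroids: for a multiset $\mathcal{A}=(A_j:j\in J)$ of subsets of a finite set $S$, the sets $\{x_k:k\in K\}$ of $|K|$ distinct elements with $K\subseteq J$, $x_k\in A_k$, are the independent sets of the matroid $M[\mathcal{A}]$ (a presentation of it). For a cyclic permutation $\sigma$ of $S$, a $\sigma$-interval is a nonempty set $[f,l]=\{f,\sigma(f),\ldots,l\}$ with first element $f$ and last element $l$. $\mathcal{I}$ is an antichain (no member contains another) of $r$ $\sigma$-intervals presenting $M$; $M$ has rank $r$, ground set size $m+r$. Diagram $D=D(\mathcal{I},1)$: let $k-1$ be the number of intervals $I\in\mathcal{I}$ with $1\in I$ and $1\neq f_I$. For $1\le i\le k$ put $p_i=(k-i,i-1)$ and $p'_i=p_i+(m,r)$; let $L,L'$ be the lines of slope $-1$ containing the $p_i$, resp. the $p'_i$. Let $P$ be the lattice path from $p_1$ to $p'_1$ whose $t$-th step ($1\le t\le m+r$) is North if $t$ is the last element of some interval of $\mathcal{I}$ and East otherwise; let $Q$ be the lattice path from $p_k$ to $p'_k$ whose $t$-th step is North if $t$ is the first element of some interval of $\mathcal{I}$ and East otherwise. The region of $D$ is the closed region bounded by $L,L',P,Q$. For $X\subseteq[m+r]$ and a lattice point $p$, $\Pi(X,p)$ is the path of $m+r$ unit steps starting at $p$ whose $u$-th step is North if $u\in X$ and East otherwise; a path is valid if it lies entirely in the region of $D$. (By a known result, $B$ is a basis of $M$ iff $\Pi(B,p_i)$ is valid and ends at $p'_i$ for some $i$.) For $v\le u+1$, $[v,u]\Pi(X,p)$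 is the portion of $\Pi(X,p)$ from the beginning of its $v$-th step to the end of its $u$-th step; $(v,u]$, $[v,u)$, $(v,u)$ are the analogous portions starting at the end of step $v$ and/or ending at the beginning of step $u$. A path touches $P$ (resp. $Q$) if it shares a point with it; a step lies in $P$ if it is an edge of $P$. For a basis $B$ (w.r.t. a linear order $<$), $u\in B$ is internally active if there is no $v\notin B$ with $v<u$ and $(B-u)\cup v$ a basis; $u\notin B$ is externally active if there is no $v\in B$ with $v<u$ and $(B-v)\cup u$ a basis. -}

module Defs where

open import Data.Nat using (ℕ; zero; suc; _+_; _∸_; _≤_; _<_; _≤ᵇ_; _<ᵇ_; _≡ᵇ_)
open import Data.Bool using (Bool; true; false; if_then_else_; _∧_; not)
open import Data.Fin using (Fin; toℕ)
import Data.Fin as Fin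
open import Data.Fin.Subset using (Subset; _∈_; _∉_; _⊆_; _∪_; _-_; ⁅_⁆)
open import Data.Vec using (Vec; []; _∷_)
open import Data.List using (allFin; map)
open import Data.Nat.ListAction using (sum)
open import Data.Bool.ListAction using (any)
open import Data.Product using (Σ; ∃; ∃-syntax; _×_; _,_; proj₁; proj₂)
open import Data.Sum using (_⊎_)
open import Relation.Nullary using (¬_)
open import Relation.Binary.PropositionalEquality using (_≡_; _≢_)
open import Function.Bundles using (_⇔_)

-- The ground set [n] = {1,…,n} is represented by Fin n: the element
-- j : Fin n stands for the number toℕ j + 1.  The cyclic permutation
-- σ = (1,2,…,n) is j ↦ j+1 (mod n).  Steps of lattice paths are
-- numbered t = 1,…,n; step t corresponds to the element with
-- toℕ-position t ∸ 1.

offset : (n f j : ℕ) → ℕ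
offset n f j = if f ≤ᵇ j then j ∸ f else (j + n) ∸ f

-- A σ-interval [f,l] = {f, σ f, …, l}: given by its first element f and
-- its number of elements len (1 ≤ len ≤ n); its last element l is the
-- element at cyclic offset len ∸ 1 from f.
record Interval (n : ℕ) : Set where
  constructor mkInterval
  field
    first  : Fin n
    len    : ℕ
    len≥1  : 1 ≤ len
    len≤n  : len ≤ n

module _ {n : ℕ} where
  open Interval

  _∈I_ : Fin n → Interval n → Set
  j ∈I I = offset n (toℕ (first I)) (toℕ j) < len I

  IsLast : Fin n → Interval n → Set
  IsLast j I = offset n (toℕ (first I)) (toℕ j) ≡ len I ∸ 1

  memᵇ : Interval n → ℕ → Bool
  memᵇ I j = (j <ᵇ n) ∧ (offset n (toℕ (first I)) j <ᵇ len I)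

  isLastᵇ : Interval n → ℕ → Bool
  isLastᵇ I j = (j <ᵇ n) ∧ (offset n (toℕ (first I)) j ≡ᵇ (len I ∸ 1))

  isFirstᵇ : Interval n → ℕ → Bool
  isFirstᵇ I j = (j <ᵇ n) ∧ (toℕ (first I) ≡ᵇ j)

  _⊆I_ : Interval n → Interval n → Set
  I ⊆I J = ∀ (j : Fin n) → j ∈I I → j ∈I J

memPos : ∀ {n} → Subset n → ℕ → Bool
memPos [] _ = false
memPos (b ∷ _) zero = b
memPos (_ ∷ xs) (suc j) = memPos xs j

-- Lattice paths.  A path is given by its start point and a word
-- w : ℕ → Bool, w t = true meaning that the t-th step is North.
Point : Set
Point = ℕ × ℕ

norths : (ℕ → Bool) → ℕ → ℕ
norths w zero = 0
norths w (suc t) = norths w t + (if w (suc t) then 1 else 0)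

pathPt : Point → (ℕ → Bool) → ℕ → Point
pathPt (x , y) w t = (x + (t ∸ norths w t) , y + norths w t)

module Setup (m r : ℕ) (𝓘 : Fin r → Interval (m + r)) where

  n : ℕ
  n = m + r

  Antichain : Set
  Antichain = ∀ (a b : Fin r) → a ≢ b → ¬ (𝓘 a ⊆I 𝓘 b)

  Independent : Subset n → Set
  Independent X =
    Σ (Subset r) λ K → Σ (Fin r → Fin n) λ x →
      (∀ k → k ∈ K → x k ∈I 𝓘 k)
      × (∀ k k' → k ∈ K → k' ∈ K → x k ≡ x k' → k ≡ k')
      × (∀ j → (j ∈ X → ∃[ k ] (k ∈ K × x k ≡ j))
               × (∀ k → k ∈ K → x k ∈ X))

  Basis : Subset n → Set
  Basis B = Independent B × (∀ X → Independent X → B ⊆ X → X ⊆ B)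

  InternallyActive : Subset n → Fin n → Set
  InternallyActive B u =
    ¬ (∃[ v ] (v ∉ B × v Fin.< u × Basis ((B - u) ∪ ⁅ v ⁆)))

  ExternallyActive : Subset n → Fin n → Set
  ExternallyActive B u =
    ¬ (∃[ v ] (v ∈ B × v Fin.< u × Basis ((B - v) ∪ ⁅ u ⁆)))

  -- k - 1 = number of intervals I with 1 ∈ I and 1 ≠ f_I
  -- (element 1 has position 0)
  k : ℕ
  k = suc (sum (map (λ a → if memᵇ (𝓘 a) 0 ∧ not (toℕ (Interval.first (𝓘 a)) ≡ᵇ 0)
                           then 1 else 0) (allFin r)))

  p : ℕ → Point
  p i = (k ∸ i , i ∸ 1)

  wordP : ℕ → Bool
  wordP t = any (λ a → isLastᵇ (𝓘 a) (t ∸ 1)) (allFin r)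

  wordQ : ℕ → Bool
  wordQ t = any (λ a → isFirstᵇ (𝓘 a) (t ∸ 1)) (allFin r)

  P : ℕ → Point
  P = pathPt (p 1) wordP

  Q : ℕ → Point
  Q = pathPt (p k) wordQ

  wordOf : Subset n → ℕ → Bool
  wordOf X t = memPos X (t ∸ 1)

  Π : Subset n → Point → ℕ → Point
  Π X q = pathPt q (wordOf X)

  -- a lattice point lies in the closed region bounded by L, L', P, Q:
  -- it lies on an antidiagonal x + y = (k - 1) + t with 0 ≤ t ≤ n
  -- (between L and L'), weakly between P and Q on that antidiagonal.
  InRegion : Point → Set
  InRegion (x , y) =
    ∃[ t ] (t ≤ n × x + y ≡ (k ∸ 1) + t
            × proj₂ (P t) ≤ y × y ≤ proj₂ (Q t))

  Valid : (ℕ → Point) → Set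
  Valid π = ∀ t → t ≤ n → InRegion (π t)

  TouchesAfter : (ℕ → Point) → ℕ → (ℕ → Point) → Set
  TouchesAfter π u ρ =
    ∃[ t ] (u ≤ t × t ≤ n × ∃[ s ] (s ≤ n × π t ≡ ρ s))

  StepIn : (ℕ → Point) → ℕ → (ℕ → Point) → Set
  StepIn π u ρ =
    ∃[ s ] (1 ≤ s × s ≤ n × π (u ∸ 1) ≡ ρ (s ∸ 1) × π u ≡ ρ s)

module Submission where

-- A set X of r elements is a basis of M[𝓘] iff, for some h ≤ k − 1, the path Π(X, p_{h+1}) stays between
-- P and Q, that is A(t) ≤ h + |X ∩ [1,t]| ≤ (k − 1) + C(t), where A(t) and C(t) count the intervals whose
-- last, resp. first, element is at most t.  A transversal yields these bounds (h counts the wrapping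
-- intervals represented at or after their first element); conversely the bounds let one match the
-- intervals to X in order, because in an antichain of σ-intervals first and last elements are ordered alike.
--
-- The exchange (B − u) ∪ v with v < u raises the path by one unit on the steps v + 1, …, u and may move its
-- start p_{h+1}.  If the u-th step lies on Q the start must move down, which a later contact with P forbids.
-- Otherwise either the step is below Q and a segment ending at u can be raised, or the path avoids P after u
-- and can start one unit lower, raised from the first non-element of B on.  External activity is the mirror
-- image, with the path lowered.

open import Defs
open import Data.Nat using (ℕ; zero; suc; _+_; _∸_; _≤_; _<_; _≤ᵇ_; _<ᵇ_; _≡ᵇ_; z≤n; s≤s)
open import Data.Nat.Properties
open import Data.Nat.ListAction using (sum)
open import Algebra.Properties.CommutativeSemigroup +-commutativeSemigroup using (interchange)
open import Data.Bool using (Bool; true; false; T; if_then_else_; _∧_; _∨_; not)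
open import Data.Bool.Properties using (∧-zeroʳ; ∧-identityʳ)
open import Data.Bool.ListAction using (any)
open import Data.Empty using (⊥; ⊥-elim)
open import Data.Fin using (Fin; toℕ)
import Data.Fin as Fin
import Data.Fin.Properties as Fin
open import Data.Fin.Subset using (Subset; _∈_; _∉_; _⊆_; _∪_; _-_; _─_; ⁅_⁆)
import Data.Fin.Subset as Subset
import Data.Fin.Subset.Properties as Subset
open import Data.List using (map; tabulate)
import Data.Product
open import Data.Product using (∃-syntax; Σ-syntax; _×_; _,_; proj₁; proj₂)
open import Data.Sum using (_⊎_; inj₁; inj₂; [_,_]′)
open import Data.Vec using ([]; _∷_; here; there)
open import Function using (_∘′_)
open import Function.Bundles using (_⇔_; mk⇔; module Equivalence)
open import Relation.Binary.Definitions using (tri<; tri≈; tri>)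
open import Relation.Binary.PropositionalEquality using (_≡_; _≢_; refl; sym; trans; cong; cong₂; subst; subst₂; module ≡-Reasoning)
open import Relation.Nullary using (¬_; Dec; yes; no)
open import Relation.Nullary.Decidable using (_×-dec_)

bit : Bool → ℕ
bit b = if b then 1 else 0

bit≤1 : ∀ b → bit b ≤ 1
bit≤1 true  = ≤-refl
bit≤1 false = z≤n

bit-mono : ∀ b c → (b ≡ true → c ≡ true) → bit b ≤ bit c
bit-mono false c f = z≤n
bit-mono true  c f rewrite f refl = ≤-refl

∧-elimˡ : ∀ b c → (b ∧ c) ≡ true → b ≡ true
∧-elimˡ true c e = refl

∧-elimʳ : ∀ b c → (b ∧ c) ≡ true → c ≡ true
∧-elimʳ true c e = e

∧-intro : ∀ {b c} → b ≡ true → c ≡ true → (b ∧ c) ≡ true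
∧-intro refl refl = refl

false≢true : false ≢ true
false≢true ()

not-true⇒false : ∀ {b} → not b ≡ true → b ≡ false
not-true⇒false {false} _ = refl

not-false⇒true : ∀ {b} → not b ≡ false → b ≡ true
not-false⇒true {true} _ = refl

≡ᵇ-refl : ∀ n → (n ≡ᵇ n) ≡ true
≡ᵇ-refl zero    = refl
≡ᵇ-refl (suc n) = ≡ᵇ-refl n

≡ᵇ-sound : ∀ m n → (m ≡ᵇ n) ≡ true → m ≡ n
≡ᵇ-sound m n e = ≡ᵇ⇒≡ m n (subst T (sym e) _)

≢⇒≡ᵇ-false : ∀ m n → m ≢ n → (m ≡ᵇ n) ≡ false
≢⇒≡ᵇ-false m n m≢n with m ≡ᵇ n in eq
... | true  = ⊥-elim (m≢n (≡ᵇ-sound m n eq))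
... | false = refl

<ᵇ-sound : ∀ m n → (m <ᵇ n) ≡ true → m < n
<ᵇ-sound m n e = <ᵇ⇒< m n (subst T (sym e) _)

<⇒<ᵇ-true : ∀ m n → m < n → (m <ᵇ n) ≡ true
<⇒<ᵇ-true m n m<n with m <ᵇ n in eq
... | true  = refl
... | false = ⊥-elim (subst T eq (<⇒<ᵇ m<n))

≮⇒<ᵇ-false : ∀ m n → ¬ (m < n) → (m <ᵇ n) ≡ false
≮⇒<ᵇ-false m n m≮n with m <ᵇ n in eq
... | true  = ⊥-elim (m≮n (<ᵇ-sound m n eq))
... | false = refl

<ᵇ-false⇒≥ : ∀ m n → (m <ᵇ n) ≡ false → n ≤ m
<ᵇ-false⇒≥ m n e = ≮⇒≥ (λ m<n → false≢true (trans (sym e) (<⇒<ᵇ-true m n m<n)))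

≤⇒≤ᵇ-true : ∀ m n → m ≤ n → (m ≤ᵇ n) ≡ true
≤⇒≤ᵇ-true m n m≤n with m ≤ᵇ n in eq
... | true  = refl
... | false = ⊥-elim (subst T eq (≤⇒≤ᵇ m≤n))

>⇒≤ᵇ-false : ∀ m n → n < m → (m ≤ᵇ n) ≡ false
>⇒≤ᵇ-false m n n<m with m ≤ᵇ n in eq
... | true  = ⊥-elim (<⇒≱ n<m (≤ᵇ⇒≤ m n (subst T (sym eq) _)))
... | false = refl

<ᵇ-cong : ∀ {m n m′ n′} → (m′ < n′ → m < n) → (m < n → m′ < n′) → (m <ᵇ n) ≡ (m′ <ᵇ n′)
<ᵇ-cong {m} {n} {m′} {n′} ⇐ ⇒ with m′ <? n′
... | yes lt = trans (<⇒<ᵇ-true m n (⇐ lt)) (sym (<⇒<ᵇ-true m′ n′ lt))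
... | no ¬lt = trans (≮⇒<ᵇ-false m n (¬lt ∘′ ⇒)) (sym (≮⇒<ᵇ-false m′ n′ ¬lt))

<ᵇ-irrefl : ∀ x → (x <ᵇ x) ≡ false
<ᵇ-irrefl x = ≮⇒<ᵇ-false x x (<-irrefl refl)

count : ∀ {r} → (Fin r → Bool) → ℕ
count {zero}  P = 0
count {suc r} P = bit (P Fin.zero) + count (λ a → P (Fin.suc a))

count-cong : ∀ {r} (P Q : Fin r → Bool) → (∀ a → P a ≡ Q a) → count P ≡ count Q
count-cong {zero}  P Q e = refl
count-cong {suc r} P Q e = cong₂ _+_ (cong bit (e Fin.zero)) (count-cong _ _ (λ a → e (Fin.suc a)))

count-mono : ∀ {r} (P Q : Fin r → Bool) → (∀ a → P a ≡ true → Q a ≡ true) → count P ≤ count Q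
count-mono {zero}  P Q f = z≤n
count-mono {suc r} P Q f = +-mono-≤ (bit-mono _ _ (f Fin.zero)) (count-mono _ _ (λ a → f (Fin.suc a)))

count≤ : ∀ {r} (P : Fin r → Bool) → count P ≤ r
count≤ {zero}  P = z≤n
count≤ {suc r} P = +-mono-≤ (bit≤1 (P Fin.zero)) (count≤ (λ a → P (Fin.suc a)))

count-all : ∀ {r} → count {r} (λ _ → true) ≡ r
count-all {zero}  = refl
count-all {suc r} = cong suc count-all

count-none : ∀ {r} (P : Fin r → Bool) → (∀ a → P a ≡ false) → count P ≡ 0
count-none {zero}  P f = refl
count-none {suc r} P f rewrite f Fin.zero = count-none _ (λ a → f (Fin.suc a))

count-witness : ∀ {r} (P : Fin r → Bool) → 1 ≤ count P → ∃[ a ] (P a ≡ true)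
count-witness {suc r} P h with P Fin.zero in eq
... | true  = Fin.zero , eq
... | false with count-witness (λ b → P (Fin.suc b)) h
... | a , e = Fin.suc a , e

count-full : ∀ {r} (P : Fin r → Bool) → count P ≡ r → ∀ a → P a ≡ true
count-full {suc r} P e a with P Fin.zero in eq
... | false = ⊥-elim (<-irrefl refl (≤-trans (≤-reflexive (sym e)) (count≤ (λ b → P (Fin.suc b)))))
count-full {suc r} P e Fin.zero    | true = eq
count-full {suc r} P e (Fin.suc a) | true = count-full (λ b → P (Fin.suc b)) (suc-injective e) a

count≤1 : ∀ {r} (P : Fin r → Bool) → (∀ a b → P a ≡ true → P b ≡ true → a ≡ b) → count P ≤ 1
count≤1 {zero}  P f = z≤n
count≤1 {suc r} P f with P Fin.zero in eq
... | true  = ≤-reflexive (cong suc (count-none _ rest-false))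
  where
  rest-false : ∀ a → P (Fin.suc a) ≡ false
  rest-false a with P (Fin.suc a) in e
  ... | true with () ← f _ _ eq e
  ... | false = refl
... | false = count≤1 (λ b → P (Fin.suc b)) (λ a b x y → Fin.suc-injective (f _ _ x y))

count-split : ∀ {r} (P Q : Fin r → Bool) → count P ≡ count (λ a → P a ∧ Q a) + count (λ a → P a ∧ not (Q a))
count-split {zero}  P Q = refl
count-split {suc r} P Q =
  trans (cong₂ _+_ (bit-split (P Fin.zero) (Q Fin.zero)) (count-split (λ a → P (Fin.suc a)) (λ a → Q (Fin.suc a))))
        (interchange (bit (P Fin.zero ∧ Q Fin.zero)) (bit (P Fin.zero ∧ not (Q Fin.zero))) _ _)
  where
  bit-split : ∀ b c → bit b ≡ bit (b ∧ c) + bit (b ∧ not c)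
  bit-split false c     = refl
  bit-split true  false = refl
  bit-split true  true  = refl

count-∪ : ∀ {r} (P Q R : Fin r → Bool) → (∀ a → P a ≡ true → Q a ≡ true ⊎ R a ≡ true) → count P ≤ count Q + count R
count-∪ {zero}  P Q R f = z≤n
count-∪ {suc r} P Q R f =
  ≤-trans (+-mono-≤ (bit-∪ _ _ _ (f Fin.zero)) (count-∪ (λ a → P (Fin.suc a)) (λ a → Q (Fin.suc a)) (λ a → R (Fin.suc a)) (λ a → f (Fin.suc a))))
          (≤-reflexive (interchange (bit (Q Fin.zero)) (bit (R Fin.zero)) _ _))
  where
  bit-∪ : ∀ p q s → (p ≡ true → q ≡ true ⊎ s ≡ true) → bit p ≤ bit q + bit s
  bit-∪ false q s f = z≤n
  bit-∪ true  q s f with f refl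
  ... | inj₁ refl = s≤s z≤n
  ... | inj₂ refl = m≤n+m 1 (bit q)

count-disjoint : ∀ {r} (P Q R : Fin r → Bool) → (∀ a → Q a ≡ true → P a ≡ true) → (∀ a → R a ≡ true → P a ≡ true)
               → (∀ a → Q a ≡ true → R a ≢ true) → count Q + count R ≤ count P
count-disjoint {zero}  P Q R f g h = z≤n
count-disjoint {suc r} P Q R f g h =
  ≤-trans (≤-reflexive (interchange (bit (Q Fin.zero)) _ (bit (R Fin.zero)) _))
    (+-mono-≤ (bit-disjoint _ _ _ (f Fin.zero) (g Fin.zero) (h Fin.zero))
              (count-disjoint (λ a → P (Fin.suc a)) (λ a → Q (Fin.suc a)) (λ a → R (Fin.suc a))
                              (λ a → f (Fin.suc a)) (λ a → g (Fin.suc a)) (λ a → h (Fin.suc a))))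
  where
  bit-disjoint : ∀ p q s → (q ≡ true → p ≡ true) → (s ≡ true → p ≡ true) → (q ≡ true → s ≢ true) → bit q + bit s ≤ bit p
  bit-disjoint p false false f g h = z≤n
  bit-disjoint p true  false f g h rewrite f refl = ≤-refl
  bit-disjoint p false true  f g h rewrite g refl = ≤-refl
  bit-disjoint p true  true  f g h = ⊥-elim (h refl refl)

count-< : ∀ {r} (P Q : Fin r → Bool) → (∀ a → P a ≡ true → Q a ≡ true) → ∀ b → P b ≡ false → Q b ≡ true → count P < count Q
count-< {suc r} P Q f Fin.zero pb qb rewrite pb | qb = s≤s (count-mono _ _ (λ a → f (Fin.suc a)))
count-< {suc r} P Q f (Fin.suc b) pb qb =
  +-mono-≤-< (bit-mono _ _ (f Fin.zero)) (count-< (λ a → P (Fin.suc a)) (λ a → Q (Fin.suc a)) (λ a → f (Fin.suc a)) b pb qb)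

count-pos : ∀ {r} (P : Fin r → Bool) a → P a ≡ true → 1 ≤ count P
count-pos P Fin.zero e rewrite e = s≤s z≤n
count-pos {suc r} P (Fin.suc a) e = ≤-trans (count-pos (λ b → P (Fin.suc b)) a e) (m≤n+m _ _)

sumTo : (ℕ → ℕ) → ℕ → ℕ
sumTo f zero    = 0
sumTo f (suc t) = sumTo f t + f t

sumTo-cong : ∀ (f g : ℕ → ℕ) t → (∀ j → j < t → f j ≡ g j) → sumTo f t ≡ sumTo g t
sumTo-cong f g zero    e = refl
sumTo-cong f g (suc t) e = cong₂ _+_ (sumTo-cong f g t (λ j j<t → e j (m<n⇒m<1+n j<t))) (e t ≤-refl)

sumTo-mono : ∀ (f g : ℕ → ℕ) t → (∀ j → j < t → f j ≤ g j) → sumTo f t ≤ sumTo g t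
sumTo-mono f g zero    e = z≤n
sumTo-mono f g (suc t) e = +-mono-≤ (sumTo-mono f g t (λ j j<t → e j (m<n⇒m<1+n j<t))) (e t ≤-refl)

sumTo-< : ∀ (f g : ℕ → ℕ) t j₀ → (∀ j → j < t → f j ≤ g j) → j₀ < t → f j₀ < g j₀ → sumTo f t < sumTo g t
sumTo-< f g (suc t) j₀ le j₀<t lt with j₀ ≟ t
... | yes refl = +-mono-≤-< (sumTo-mono f g j₀ (λ j j< → le j (m<n⇒m<1+n j<))) lt
... | no j₀≢t  = +-mono-<-≤ (sumTo-< f g t j₀ (λ j j< → le j (m<n⇒m<1+n j<)) (≤∧≢⇒< (≤-pred j₀<t) j₀≢t) lt) (le t ≤-refl)

sumTo-+ : ∀ (f g : ℕ → ℕ) t → sumTo (λ j → f j + g j) t ≡ sumTo f t + sumTo g t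
sumTo-+ f g zero    = refl
sumTo-+ f g (suc t) rewrite sumTo-+ f g t = interchange (sumTo f t) (sumTo g t) (f t) (g t)

sumTo-zero : ∀ (f : ℕ → ℕ) t → (∀ j → j < t → f j ≡ 0) → sumTo f t ≡ 0
sumTo-zero f zero    e = refl
sumTo-zero f (suc t) e rewrite sumTo-zero f t (λ j j<t → e j (m<n⇒m<1+n j<t)) = e t ≤-refl

sumTo-single : ∀ (f : ℕ → ℕ) j₀ t → (∀ j → j ≢ j₀ → f j ≡ 0) → j₀ < t → sumTo f t ≡ f j₀
sumTo-single f j₀ (suc t) e lt with j₀ ≟ t
... | yes refl = cong (_+ f j₀) (sumTo-zero f j₀ (λ j j<j₀ → e j (<⇒≢ j<j₀)))
... | no j₀≢t  = trans (cong₂ _+_ (sumTo-single f j₀ t e (≤∧≢⇒< (≤-pred lt) j₀≢t)) (e t (j₀≢t ∘′ sym))) (+-identityʳ _)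

sumTo-prefix : ∀ (q : ℕ → Bool) t T → t ≤ T → sumTo (λ j → bit ((j <ᵇ t) ∧ q j)) T ≡ sumTo (λ j → bit (q j)) t
sumTo-prefix q t zero    z≤n = refl
sumTo-prefix q t (suc T) le with t ≤? T
... | yes t≤T rewrite sumTo-prefix q t T t≤T | ≮⇒<ᵇ-false T t (λ T<t → <⇒≱ T<t t≤T) = +-identityʳ _
... | no t≰T with refl ← ≤-antisym le (≰⇒> t≰T)
  = sumTo-cong _ _ (suc T) (λ j j<t → cong (λ b → bit (b ∧ q j)) (<⇒<ᵇ-true j (suc T) j<t))


fibre : ∀ {r} (R : Fin r → Bool) (g : Fin r → ℕ) → ℕ → ℕ
fibre R g j = count (λ a → R a ∧ (g a ≡ᵇ j))

count-by-fibres : ∀ {r} (R : Fin r → Bool) (g : Fin r → ℕ) (q : ℕ → Bool) T → (∀ a → g a < T) →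
                  count (λ a → R a ∧ q (g a)) ≡ sumTo (λ j → if q j then fibre R g j else 0) T
count-by-fibres {zero} R g q T g<T = sym (sumTo-zero _ T (λ j _ → if-0 (q j)))
  where
  if-0 : ∀ b → (if b then 0 else 0) ≡ 0
  if-0 true  = refl
  if-0 false = refl
count-by-fibres {suc r} R g q T g<T =
  sym (trans (sumTo-cong _ _ T (λ j _ → if-+ (q j) (bit (R a₀ ∧ (g a₀ ≡ᵇ j))) _))
      (trans (sumTo-+ _ _ T)
      (cong₂ _+_ (trans (sumTo-single _ (g a₀) T off-g₀ (g<T a₀)) (at-g₀ (R a₀) (q (g a₀))))
                 (sym (count-by-fibres (λ a → R (Fin.suc a)) (λ a → g (Fin.suc a)) q T (λ a → g<T (Fin.suc a)))))))
  where
  a₀ = Fin.zero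
  if-+ : ∀ (b : Bool) x y → (if b then x + y else 0) ≡ (if b then x else 0) + (if b then y else 0)
  if-+ true  x y = refl
  if-+ false x y = refl
  off-g₀ : ∀ j → j ≢ g a₀ → (if q j then bit (R a₀ ∧ (g a₀ ≡ᵇ j)) else 0) ≡ 0
  off-g₀ j j≢ rewrite ≢⇒≡ᵇ-false (g a₀) j (j≢ ∘′ sym) | ∧-zeroʳ (R a₀) with q j
  ... | true  = refl
  ... | false = refl
  at-g₀ : ∀ R₀ b → (if b then bit (R₀ ∧ (g a₀ ≡ᵇ g a₀)) else 0) ≡ bit (R₀ ∧ b)
  at-g₀ R₀ true  rewrite ≡ᵇ-refl (g a₀) | ∧-identityʳ R₀ = refl
  at-g₀ R₀ false rewrite ∧-zeroʳ R₀ = refl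

count-injective-image : ∀ {r} (R : Fin r → Bool) (g : Fin r → ℕ) (q : ℕ → Bool) T → (∀ a → g a < T) →
                        (∀ a b → R a ≡ true → R b ≡ true → g a ≡ g b → a ≡ b) →
                        count (λ a → R a ∧ q (g a)) ≤ sumTo (λ j → bit (q j)) T
count-injective-image R g q T g<T inj =
  ≤-trans (≤-reflexive (count-by-fibres R g q T g<T)) (sumTo-mono _ _ T (λ j _ → fibre≤bit j (q j)))
  where
  fibre≤bit : ∀ j b → (if b then fibre R g j else 0) ≤ bit b
  fibre≤bit j true  = count≤1 _ (λ a b x y → inj a b (∧-elimˡ _ _ x) (∧-elimˡ _ _ y)
                        (trans (≡ᵇ-sound _ _ (∧-elimʳ _ _ x)) (sym (≡ᵇ-sound _ _ (∧-elimʳ _ _ y)))))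
  fibre≤bit j false = z≤n

count-surjective-image : ∀ {r} (R : Fin r → Bool) (g : Fin r → ℕ) (q : ℕ → Bool) T → (∀ a → g a < T) →
                         (∀ j → j < T → q j ≡ true → ∃[ a ] (R a ≡ true × g a ≡ j)) →
                         sumTo (λ j → bit (q j)) T ≤ count (λ a → R a ∧ q (g a))
count-surjective-image R g q T g<T sur =
  ≤-trans (sumTo-mono _ _ T (λ j j<T → bit≤fibre j j<T (q j) refl)) (≤-reflexive (sym (count-by-fibres R g q T g<T)))
  where
  bit≤fibre : ∀ j → j < T → ∀ b → q j ≡ b → bit b ≤ (if b then fibre R g j else 0)
  bit≤fibre j j<T true  e with sur j j<T e
  ... | a , Ra , refl = count-pos _ a (∧-intro Ra (≡ᵇ-refl (g a)))
  bit≤fibre j j<T false e = z≤n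

UnitSteps : (ℕ → ℕ) → Set
UnitSteps f = f 0 ≡ 0 × (∀ t → f (suc t) ≤ suc (f t))

unitSteps-cross : ∀ f → UnitSteps f → ∀ N j → j < f N → ∃[ τ ] (τ < N × f τ ≡ j × f (suc τ) ≡ suc j)
unitSteps-cross f (f0 , st) zero j lt rewrite f0 with () ← lt
unitSteps-cross f (f0 , st) (suc N) j lt with j <? f N
... | yes j<fN =
  let τ , τ<N , e₁ , e₂ = unitSteps-cross f (f0 , st) N j j<fN in τ , m<n⇒m<1+n τ<N , e₁ , e₂
... | no j≮fN =
  let fN≡j = ≤-antisym (≮⇒≥ j≮fN) (≤-pred (≤-trans lt (st N)))
  in N , ≤-refl , fN≡j , ≤-antisym (≤-trans (st N) (s≤s (≤-reflexive fN≡j))) lt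

unitSteps-hit : ∀ f → UnitSteps f → ∀ N h → h ≤ f N → ∃[ τ ] (τ ≤ N × f τ ≡ h)
unitSteps-hit f us N h h≤fN with m≤n⇒m<n∨m≡n h≤fN
... | inj₁ h<fN = let τ , τ<N , e , _ = unitSteps-cross f us N h h<fN in τ , <⇒≤ τ<N , e
... | inj₂ refl = N , ≤-refl , refl

norths≡sumTo : ∀ w t → norths w t ≡ sumTo (λ j → bit (w (suc j))) t
norths≡sumTo w zero    = refl
norths≡sumTo w (suc t) = cong (_+ bit (w (suc t))) (norths≡sumTo w t)

norths-suc≤ : ∀ w t → norths w (suc t) ≤ suc (norths w t)
norths-suc≤ w t = ≤-trans (+-monoʳ-≤ (norths w t) (bit≤1 (w (suc t)))) (≤-reflexive (+-comm (norths w t) 1))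

norths-unitSteps : ∀ w → UnitSteps (norths w)
norths-unitSteps w = refl , norths-suc≤ w

norths≤ : ∀ w t → norths w t ≤ t
norths≤ w zero    = z≤n
norths≤ w (suc t) = ≤-trans (norths-suc≤ w t) (s≤s (norths≤ w t))

norths-mono : ∀ w {s t} → s ≤ t → norths w s ≤ norths w t
norths-mono w {t = zero}  z≤n = z≤n
norths-mono w {s} {suc t} s≤1+t with m≤n⇒m<n∨m≡n s≤1+t
... | inj₁ s<1+t = ≤-trans (norths-mono w (≤-pred s<1+t)) (m≤m+n _ _)
... | inj₂ refl  = ≤-refl

firstFailure : (q : ℕ → Bool) → ∀ t →
  (∀ j → j < t → q j ≡ true) ⊎ ∃[ j ] (j < t × q j ≡ false × (∀ j′ → j′ < j → q j′ ≡ true))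
firstFailure q zero = inj₁ (λ j ())
firstFailure q (suc t) with firstFailure q t | q t in qt
... | inj₂ (j , j<t , qj , before) | _ = inj₂ (j , m<n⇒m<1+n j<t , qj , before)
... | inj₁ all | false = inj₂ (t , ≤-refl , qt , all)
... | inj₁ all | true  = inj₁ λ j j<1+t → [ all j , (λ { refl → qt }) ]′ (m<1+n⇒m<n∨m≡n j<1+t)

search : (P : ℕ → Set) → (∀ t → Dec (P t)) → ∀ lo hi →
         (∃[ t ] (lo ≤ t × t ≤ hi × P t)) ⊎ (∀ t → lo ≤ t → t ≤ hi → ¬ P t)
search P P? lo hi with anyUpTo? (λ t → (lo ≤? t) ×-dec P? t) (suc hi)
... | yes (t , t<1+hi , lo≤t , Pt) = inj₁ (t , lo≤t , ≤-pred t<1+hi , Pt)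
... | no none                      = inj₂ λ t lo≤t t≤hi Pt → none (t , s≤s t≤hi , lo≤t , Pt)

∸≡⇒≡+ : ∀ {x c b} → c ≤ x → x ∸ c ≡ b → x ≡ c + b
∸≡⇒≡+ c≤x refl = sym (m+[n∸m]≡n c≤x)

∸<⇒<+ : ∀ {x c L} → c ≤ x → x ∸ c < L → x < c + L
∸<⇒<+ {c = c} {L} c≤x lt = subst (_< c + L) (m+[n∸m]≡n c≤x) (+-monoʳ-< c lt)

<+⇒∸< : ∀ {x c L} → c ≤ x → x < c + L → x ∸ c < L
<+⇒∸< {c = c} {L} c≤x lt = +-cancelˡ-< c _ _ (subst (_< c + L) (sym (m+[n∸m]≡n c≤x)) lt)

module _ {n : ℕ} where
  open Interval

  firstPos : Interval n → ℕ
  firstPos I = toℕ (first I)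

  wraps : Interval n → Bool
  wraps I = n <ᵇ firstPos I + len I

  lastPos : Interval n → ℕ
  lastPos I = if wraps I then firstPos I + len I ∸ suc n else firstPos I + len I ∸ 1

  Covers : Interval n → ℕ → Set
  Covers I j = offset n (firstPos I) j < len I

  firstPos<n : ∀ I → firstPos I < n
  firstPos<n I = Fin.toℕ<n (first I)

  nonwrapping-end : ∀ I → wraps I ≡ false → suc (lastPos I) ≡ firstPos I + len I
  nonwrapping-end I e rewrite e = m+[n∸m]≡n {1} (≤-trans (len≥1 I) (m≤n+m (len I) (firstPos I)))

  wrapping-end : ∀ I → wraps I ≡ true → suc (lastPos I + n) ≡ firstPos I + len I
  wrapping-end I e rewrite e = trans (sym (+-suc (firstPos I + len I ∸ suc n) n)) (m∸n+n≡m (<ᵇ-sound n _ e))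

  lastPos<n : ∀ I → lastPos I < n
  lastPos<n I = by-wrapping (wraps I) refl
    where
    by-wrapping : ∀ b → wraps I ≡ b → lastPos I < n
    by-wrapping false e = subst (_≤ n) (sym (nonwrapping-end I e)) (<ᵇ-false⇒≥ n _ e)
    by-wrapping true  e = <⇒≤ (+-cancelʳ-≤ n (suc (suc (lastPos I))) n
                            (≤-trans (≤-reflexive (cong suc (wrapping-end I e))) (+-mono-≤ (firstPos<n I) (len≤n I))))

  wrapping-last<first : ∀ I → wraps I ≡ true → lastPos I < firstPos I
  wrapping-last<first I e = +-cancelʳ-≤ n _ _ (≤-trans (≤-reflexive (wrapping-end I e)) (+-monoʳ-≤ (firstPos I) (len≤n I)))

  nonwrapping-first≤last : ∀ I → wraps I ≡ false → firstPos I ≤ lastPos I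
  nonwrapping-first≤last I e = ≤-pred (subst (suc (firstPos I) ≤_) (sym (nonwrapping-end I e))
                                 (subst (_≤ firstPos I + len I) (+-comm (firstPos I) 1) (+-monoʳ-≤ (firstPos I) (len≥1 I))))

  offset-≤ : ∀ f j → f ≤ j → offset n f j ≡ j ∸ f
  offset-≤ f j f≤j rewrite ≤⇒≤ᵇ-true f j f≤j = refl

  offset-> : ∀ f j → j < f → offset n f j ≡ (j + n) ∸ f
  offset-> f j j<f rewrite >⇒≤ᵇ-false f j j<f = refl

  covers⇒ : ∀ I j → j < n → Covers I j → (firstPos I ≤ j × j < firstPos I + len I) ⊎ (j + n < firstPos I + len I)
  covers⇒ I j j<n lt with firstPos I ≤? j
  ... | yes f≤j = inj₁ (f≤j , ∸<⇒<+ f≤j (subst (_< len I) (offset-≤ (firstPos I) j f≤j) lt))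
  ... | no f≰j  = inj₂ (∸<⇒<+ (≤-trans (<⇒≤ (firstPos<n I)) (m≤n+m n j)) (subst (_< len I) (offset-> (firstPos I) j (≰⇒> f≰j)) lt))

  covers-after-first : ∀ I j → firstPos I ≤ j → j < firstPos I + len I → Covers I j
  covers-after-first I j f≤j lt = subst (_< len I) (sym (offset-≤ (firstPos I) j f≤j)) (<+⇒∸< f≤j lt)

  covers-before-first : ∀ I j → j + n < firstPos I + len I → Covers I j
  covers-before-first I j lt with firstPos I ≤? j
  ... | yes f≤j = ⊥-elim (<⇒≱ (≤-trans lt (+-mono-≤ f≤j (len≤n I))) ≤-refl)
  ... | no f≰j  = subst (_< len I) (sym (offset-> (firstPos I) j (≰⇒> f≰j)))
                    (<+⇒∸< (≤-trans (<⇒≤ (firstPos<n I)) (m≤n+m n j)) lt)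

  nonwrapping-covers⇒ : ∀ I j → j < n → wraps I ≡ false → Covers I j → firstPos I ≤ j × j ≤ lastPos I
  nonwrapping-covers⇒ I j j<n e c with covers⇒ I j j<n c
  ... | inj₁ (f≤j , lt) = f≤j , ≤-pred (subst (j <_) (sym (nonwrapping-end I e)) lt)
  ... | inj₂ lt         = ⊥-elim (<⇒≱ (≤-trans lt (<ᵇ-false⇒≥ n _ e)) (m≤n+m n j))

  nonwrapping-covers : ∀ I j → wraps I ≡ false → firstPos I ≤ j → j ≤ lastPos I → Covers I j
  nonwrapping-covers I j e f≤j j≤l = covers-after-first I j f≤j (subst (j <_) (nonwrapping-end I e) (s≤s j≤l))

  wrapping-covers⇒ : ∀ I j → j < n → wraps I ≡ true → Covers I j → firstPos I ≤ j ⊎ j ≤ lastPos I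
  wrapping-covers⇒ I j j<n e c with covers⇒ I j j<n c
  ... | inj₁ (f≤j , _) = inj₁ f≤j
  ... | inj₂ lt        = inj₂ (≤-pred (+-cancelʳ-< n j (suc (lastPos I)) (subst (j + n <_) (sym (wrapping-end I e)) lt)))

  wrapping-covers-tail : ∀ I j → j < n → wraps I ≡ true → firstPos I ≤ j → Covers I j
  wrapping-covers-tail I j j<n e f≤j = covers-after-first I j f≤j (<-trans j<n (<ᵇ-sound n _ e))

  wrapping-covers-head : ∀ I j → wraps I ≡ true → j ≤ lastPos I → Covers I j
  wrapping-covers-head I j e j≤l = covers-before-first I j (subst (j + n <_) (wrapping-end I e) (s≤s (+-monoˡ-≤ n j≤l)))

  end≡suc : ∀ I → firstPos I + len I ≡ suc (firstPos I + (len I ∸ 1))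
  end≡suc I = trans (cong (firstPos I +_) (sym (m+[n∸m]≡n {1} (len≥1 I)))) (+-suc (firstPos I) (len I ∸ 1))

  isLast⇒ : ∀ I j → isLastᵇ I j ≡ true → j ≡ lastPos I
  isLast⇒ I j e with firstPos I ≤? j
  ... | yes f≤j =
    let j<n  = <ᵇ-sound j n (∧-elimˡ _ _ e)
        eq   : suc j ≡ firstPos I + len I
        eq   = trans (cong suc (∸≡⇒≡+ f≤j (trans (sym (offset-≤ (firstPos I) j f≤j)) (≡ᵇ-sound _ _ (∧-elimʳ _ _ e)))))
                     (sym (end≡suc I))
        nonw = ≮⇒<ᵇ-false n _ (λ lt → <⇒≱ lt (subst (_≤ n) eq j<n))
    in suc-injective (trans eq (sym (nonwrapping-end I nonw)))
  ... | no f≰j =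
    let eq : suc (j + n) ≡ firstPos I + len I
        eq = trans (cong suc (∸≡⇒≡+ (≤-trans (<⇒≤ (firstPos<n I)) (m≤n+m n j))
                                 (trans (sym (offset-> (firstPos I) j (≰⇒> f≰j))) (≡ᵇ-sound _ _ (∧-elimʳ _ _ e)))))
                   (sym (end≡suc I))
        w  = <⇒<ᵇ-true n _ (subst (n <_) eq (s≤s (m≤n+m n j)))
    in +-cancelʳ-≡ n j (lastPos I) (suc-injective (trans eq (sym (wrapping-end I w))))

  isLast⇐ : ∀ I → isLastᵇ I (lastPos I) ≡ true
  isLast⇐ I = ∧-intro (<⇒<ᵇ-true _ n (lastPos<n I)) (subst (λ x → (x ≡ᵇ (len I ∸ 1)) ≡ true) (sym (offset≡ (wraps I) refl)) (≡ᵇ-refl (len I ∸ 1)))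
    where
    offset≡ : ∀ b → wraps I ≡ b → offset n (firstPos I) (lastPos I) ≡ len I ∸ 1
    offset≡ false e = trans (offset-≤ (firstPos I) (lastPos I) (nonwrapping-first≤last I e))
                            (trans (cong (_∸ firstPos I) (suc-injective (trans (nonwrapping-end I e) (end≡suc I))))
                                   (m+n∸m≡n (firstPos I) _))
    offset≡ true e  = trans (offset-> (firstPos I) (lastPos I) (wrapping-last<first I e))
                            (trans (cong (_∸ firstPos I) (suc-injective (trans (wrapping-end I e) (end≡suc I))))
                                   (m+n∸m≡n (firstPos I) _))

  isFirst⇒ : ∀ I j → isFirstᵇ I j ≡ true → j ≡ firstPos I
  isFirst⇒ I j e = sym (≡ᵇ-sound _ _ (∧-elimʳ _ _ e))

  isFirst⇐ : ∀ I → isFirstᵇ I (firstPos I) ≡ true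
  isFirst⇐ I = ∧-intro (<⇒<ᵇ-true _ n (firstPos<n I)) (≡ᵇ-refl (firstPos I))

  covers0-not-first≡wraps : ∀ I → (memᵇ I 0 ∧ not (firstPos I ≡ᵇ 0)) ≡ wraps I
  covers0-not-first≡wraps I with firstPos I ≟ 0
  ... | yes f≡0 = trans (cong (λ b → memᵇ I 0 ∧ not b) (subst (λ f → (f ≡ᵇ 0) ≡ true) (sym f≡0) refl))
                   (trans (∧-zeroʳ _) (sym (≮⇒<ᵇ-false n _ (λ lt → <⇒≱ lt (subst (λ f → f + len I ≤ n) (sym f≡0) (len≤n I))))))
  ... | no f≢0 rewrite ≢⇒≡ᵇ-false _ _ f≢0 | ∧-identityʳ (memᵇ I 0)
                     | <⇒<ᵇ-true 0 n (≤-<-trans z≤n (firstPos<n I)) | offset-> (firstPos I) 0 (n≢0⇒n>0 f≢0) =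
    <ᵇ-cong (<+⇒∸< f≤n) (∸<⇒<+ f≤n)
    where
    f≤n = <⇒≤ (firstPos<n I)

  ⊆I-nonwrapping : ∀ I J → wraps I ≡ false → wraps J ≡ false → firstPos J ≤ firstPos I → lastPos I ≤ lastPos J → I ⊆I J
  ⊆I-nonwrapping I J wI wJ fJ≤fI lI≤lJ j j∈I =
    let fI≤j , j≤lI = nonwrapping-covers⇒ I (toℕ j) (Fin.toℕ<n j) wI j∈I
    in nonwrapping-covers J (toℕ j) wJ (≤-trans fJ≤fI fI≤j) (≤-trans j≤lI lI≤lJ)

  ⊆I-wrapping : ∀ I J → wraps I ≡ true → wraps J ≡ true → firstPos J ≤ firstPos I → lastPos I ≤ lastPos J → I ⊆I J
  ⊆I-wrapping I J wI wJ fJ≤fI lI≤lJ j j∈I with wrapping-covers⇒ I (toℕ j) (Fin.toℕ<n j) wI j∈I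
  ... | inj₁ fI≤j = wrapping-covers-tail J (toℕ j) (Fin.toℕ<n j) wJ (≤-trans fJ≤fI fI≤j)
  ... | inj₂ j≤lI = wrapping-covers-head J (toℕ j) wJ (≤-trans j≤lI lI≤lJ)

  ⊆I-into-wrapping : ∀ I J → wraps I ≡ false → wraps J ≡ true → firstPos J ≤ firstPos I ⊎ lastPos I ≤ lastPos J → I ⊆I J
  ⊆I-into-wrapping I J wI wJ ends j j∈I with nonwrapping-covers⇒ I (toℕ j) (Fin.toℕ<n j) wI j∈I | ends
  ... | fI≤j , _ | inj₁ fJ≤fI = wrapping-covers-tail J (toℕ j) (Fin.toℕ<n j) wJ (≤-trans fJ≤fI fI≤j)
  ... | _ , j≤lI | inj₂ lI≤lJ = wrapping-covers-head J (toℕ j) wJ (≤-trans j≤lI lI≤lJ)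

  ⊆I-same-first : ∀ I J → firstPos I ≡ firstPos J → len I ≤ len J → I ⊆I J
  ⊆I-same-first I J fI≡fJ lenI≤lenJ j j∈I = subst (λ f → offset n f (toℕ j) < len J) fI≡fJ (≤-trans j∈I lenI≤lenJ)

∈⇒memPos : ∀ {n} (X : Subset n) {x} → x ∈ X → memPos X (toℕ x) ≡ true
∈⇒memPos (_ ∷ X) here      = refl
∈⇒memPos (_ ∷ X) (there p) = ∈⇒memPos X p

memPos⇒∈ : ∀ {n} (X : Subset n) x → memPos X (toℕ x) ≡ true → x ∈ X
memPos⇒∈ (true ∷ X)  Fin.zero    e = here
memPos⇒∈ (_ ∷ X)     (Fin.suc x) e = there (memPos⇒∈ X x e)

∉⇒memPos : ∀ {n} (X : Subset n) {x} → x ∉ X → memPos X (toℕ x) ≡ false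
∉⇒memPos X {x} x∉X with memPos X (toℕ x) in e
... | true  = ⊥-elim (x∉X (memPos⇒∈ X x e))
... | false = refl

memPos⇒< : ∀ {n} (X : Subset n) j → memPos X j ≡ true → j < n
memPos⇒< (_ ∷ X) zero    e = s≤s z≤n
memPos⇒< (_ ∷ X) (suc j) e = s≤s (memPos⇒< X j e)

memPos-fromℕ< : ∀ {n} (X : Subset n) {j} (j<n : j < n) → memPos X (toℕ (Fin.fromℕ< j<n)) ≡ memPos X j
memPos-fromℕ< X j<n = cong (memPos X) (Fin.toℕ-fromℕ< j<n)

⊆⇒memPos : ∀ {n} (X Y : Subset n) → X ⊆ Y → ∀ j → memPos X j ≡ true → memPos Y j ≡ true
⊆⇒memPos X Y X⊆Y j e =
  let j<n = memPos⇒< X j e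
  in trans (sym (memPos-fromℕ< Y j<n)) (∈⇒memPos Y (X⊆Y (memPos⇒∈ X _ (trans (memPos-fromℕ< X j<n) e))))

memPos-∪ : ∀ {n} (X Y : Subset n) j → memPos (X ∪ Y) j ≡ (memPos X j ∨ memPos Y j)
memPos-∪ []      []      j       = refl
memPos-∪ (x ∷ X) (y ∷ Y) zero    = refl
memPos-∪ (x ∷ X) (y ∷ Y) (suc j) = memPos-∪ X Y j

memPos-─ : ∀ {n} (X Y : Subset n) j → memPos (X ─ Y) j ≡ (memPos X j ∧ not (memPos Y j))
memPos-─ []      []          j       = refl
memPos-─ (x ∷ X) (true ∷ Y)  zero    = sym (∧-zeroʳ x)
memPos-─ (x ∷ X) (false ∷ Y) zero    = sym (∧-identityʳ x)
memPos-─ (x ∷ X) (y ∷ Y)     (suc j) = memPos-─ X Y j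

memPos-⊥ : ∀ {n} j → memPos (Subset.⊥ {n}) j ≡ false
memPos-⊥ {zero}  j       = refl
memPos-⊥ {suc n} zero    = refl
memPos-⊥ {suc n} (suc j) = memPos-⊥ {n} j

memPos-⁅⁆ : ∀ {n} (v : Fin n) j → memPos ⁅ v ⁆ j ≡ (toℕ v ≡ᵇ j)
memPos-⁅⁆ Fin.zero            zero    = refl
memPos-⁅⁆ {suc n} Fin.zero    (suc j) = memPos-⊥ {n} j
memPos-⁅⁆ (Fin.suc v)         zero    = refl
memPos-⁅⁆ (Fin.suc v)         (suc j) = memPos-⁅⁆ v j

card< : ∀ {n} → Subset n → ℕ → ℕ
card< X = norths (λ s → memPos X (s ∸ 1))

card<≡sumTo : ∀ {n} (X : Subset n) t T → t ≤ T → card< X t ≡ sumTo (λ j → bit ((j <ᵇ t) ∧ memPos X j)) T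
card<≡sumTo X t T t≤T = trans (norths≡sumTo _ t) (sym (sumTo-prefix (memPos X) t T t≤T))

card<-suc-∈ : ∀ {n} (X : Subset n) j → memPos X j ≡ true → card< X (suc j) ≡ suc (card< X j)
card<-suc-∈ X j e rewrite e = +-comm (card< X j) 1

card<-suc-∉ : ∀ {n} (X : Subset n) j → memPos X j ≡ false → card< X (suc j) ≡ card< X j
card<-suc-∉ X j e rewrite e = +-identityʳ (card< X j)

card<-full : ∀ {n} (X : Subset n) t → (∀ j → j < t → memPos X j ≡ true) → card< X t ≡ t
card<-full X zero    f = refl
card<-full X (suc t) f = trans (card<-suc-∈ X t (f t ≤-refl)) (cong suc (card<-full X t (λ j j< → f j (m<n⇒m<1+n j<))))

card<-empty : ∀ {n} (X : Subset n) t → (∀ j → j < t → memPos X j ≡ false) → card< X t ≡ 0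
card<-empty X zero    f = refl
card<-empty X (suc t) f = trans (card<-suc-∉ X t (f t ≤-refl)) (card<-empty X t (λ j j< → f j (m<n⇒m<1+n j<)))

card<-gap : ∀ {n} (X : Subset n) t j → j < t → memPos X j ≡ false → card< X t < t
card<-gap X (suc t) j j<1+t e with m<1+n⇒m<n∨m≡n j<1+t
... | inj₂ refl = subst (_< suc j) (sym (card<-suc-∉ X j e)) (s≤s (norths≤ _ j))
... | inj₁ j<t  = s≤s (≤-trans (norths-suc≤ _ t) (card<-gap X t j j<t e))

card<-mono-⊆ : ∀ {n} (X Y : Subset n) → (∀ j → memPos X j ≡ true → memPos Y j ≡ true) → ∀ t → card< X t ≤ card< Y t
card<-mono-⊆ X Y f t = ≤-trans (≤-reflexive (norths≡sumTo _ t))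
                         (≤-trans (sumTo-mono _ _ t (λ j _ → bit-mono _ _ (f j))) (≤-reflexive (sym (norths≡sumTo _ t))))

rank-mono⇒≤ : ∀ {n} (X : Subset n) e F → memPos X e ≡ true → card< X F ≤ card< X e → F ≤ e
rank-mono⇒≤ X e F Xe le with F ≤? e
... | yes F≤e = F≤e
... | no F≰e  = ⊥-elim (<-irrefl refl (≤-trans (≤-reflexive (sym (card<-suc-∈ X e Xe))) (≤-trans (norths-mono _ (≰⇒> F≰e)) le)))

rank<⇒≤ : ∀ {n} (X : Subset n) e L → card< X e < card< X (suc L) → e ≤ L
rank<⇒≤ X e L lt with e ≤? L
... | yes e≤L = e≤L
... | no e≰L  = ⊥-elim (<-irrefl refl (≤-trans lt (norths-mono _ (≰⇒> e≰L))))

rank-injective : ∀ {n} (X : Subset n) e e′ → memPos X e ≡ true → memPos X e′ ≡ true → card< X e ≡ card< X e′ → e ≡ e′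
rank-injective X e e′ Xe Xe′ eq with <-cmp e e′
... | tri≈ _ e≡e′ _ = e≡e′
... | tri< e<e′ _ _ = ⊥-elim (<-irrefl eq (≤-trans (≤-reflexive (sym (card<-suc-∈ X e Xe))) (norths-mono _ e<e′)))
... | tri> _ _ e′<e = ⊥-elim (<-irrefl (sym eq) (≤-trans (≤-reflexive (sym (card<-suc-∈ X e′ Xe′))) (norths-mono _ e′<e)))

element-of-rank : ∀ {n} (X : Subset n) j → j < card< X n → ∃[ e ] (e < n × memPos X e ≡ true × card< X e ≡ j)
element-of-rank {n} X j lt with unitSteps-cross (card< X) (norths-unitSteps _) n j lt
... | e , e<n , rank≡j , rank+1≡1+j = e , e<n , in-X (memPos X e) refl , rank≡j
  where
  in-X : ∀ b → memPos X e ≡ b → memPos X e ≡ true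
  in-X true  Xe = Xe
  in-X false Xe = ⊥-elim (<-irrefl (trans (sym rank≡j) (trans (sym (card<-suc-∉ X e Xe)) rank+1≡1+j)) (n<1+n j))

bit<ᵇ-suc : ∀ x t → bit (x <ᵇ suc t) ≡ bit (x <ᵇ t) + bit (x ≡ᵇ t)
bit<ᵇ-suc x t with <-cmp x t
... | tri< x<t x≢t _ rewrite <⇒<ᵇ-true x (suc t) (m<n⇒m<1+n x<t) | <⇒<ᵇ-true x t x<t | ≢⇒≡ᵇ-false x t x≢t = refl
... | tri≈ _ refl _ rewrite <⇒<ᵇ-true x (suc x) ≤-refl | <ᵇ-irrefl x | ≡ᵇ-refl x = refl
... | tri> x≮t x≢t t<x rewrite ≮⇒<ᵇ-false x (suc t) (<⇒≱ t<x ∘′ ≤-pred) | ≮⇒<ᵇ-false x t x≮t | ≢⇒≡ᵇ-false x t x≢t = refl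

card<-insert : ∀ {n} (B : Subset n) (y : Fin n) → memPos B (toℕ y) ≡ false →
               ∀ t → card< (B ∪ ⁅ y ⁆) t ≡ card< B t + bit (toℕ y <ᵇ t)
card<-insert B y By zero    = refl
card<-insert B y By (suc t) =
  trans (cong₂ _+_ (card<-insert B y By t) step)
  (trans (interchange (card< B t) (bit (toℕ y <ᵇ t)) (bit (memPos B t)) (bit (toℕ y ≡ᵇ t)))
  (cong ((card< B t + bit (memPos B t)) +_) (sym (bit<ᵇ-suc (toℕ y) t))))
  where
  step : bit (memPos (B ∪ ⁅ y ⁆) t) ≡ bit (memPos B t) + bit (toℕ y ≡ᵇ t)
  step rewrite memPos-∪ B ⁅ y ⁆ t | memPos-⁅⁆ y t with toℕ y ≟ t
  ... | yes refl rewrite ≡ᵇ-refl (toℕ y) | By = refl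
  ... | no y≢t rewrite ≢⇒≡ᵇ-false (toℕ y) t y≢t with memPos B t
  ...   | true  = refl
  ...   | false = refl

card<-insert-all : ∀ {n} (B : Subset n) (y : Fin n) → memPos B (toℕ y) ≡ false → card< (B ∪ ⁅ y ⁆) n ≡ card< B n + 1
card<-insert-all {n} B y By = trans (card<-insert B y By n) (cong (λ b → card< B n + bit b) (<⇒<ᵇ-true _ n (Fin.toℕ<n y)))

module Exchange {n} (B : Subset n) (x y : Fin n) (Bx : memPos B (toℕ x) ≡ true) (By : memPos B (toℕ y) ≡ false) where

  exchanged : Subset n
  exchanged = (B - x) ∪ ⁅ y ⁆

  card<-balance : ∀ t → card< exchanged t + bit (toℕ x <ᵇ t) ≡ card< B t + bit (toℕ y <ᵇ t)
  card<-balance zero    = refl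
  card<-balance (suc t) =
    trans (cong ((card< exchanged t + bit (memPos exchanged t)) +_) (bit<ᵇ-suc (toℕ x) t))
    (trans (interchange (card< exchanged t) (bit (memPos exchanged t)) (bit (toℕ x <ᵇ t)) (bit (toℕ x ≡ᵇ t)))
    (trans (cong₂ _+_ (card<-balance t) step)
    (trans (interchange (card< B t) (bit (toℕ y <ᵇ t)) (bit (memPos B t)) (bit (toℕ y ≡ᵇ t)))
    (cong ((card< B t + bit (memPos B t)) +_) (sym (bit<ᵇ-suc (toℕ y) t))))))
    where
    step : bit (memPos exchanged t) + bit (toℕ x ≡ᵇ t) ≡ bit (memPos B t) + bit (toℕ y ≡ᵇ t)
    step rewrite memPos-∪ (B - x) ⁅ y ⁆ t | memPos-─ B ⁅ x ⁆ t | memPos-⁅⁆ x t | memPos-⁅⁆ y t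
      with toℕ x ≟ t | toℕ y ≟ t
    ... | yes refl | yes y≡x = ⊥-elim (false≢true (trans (sym By) (subst (λ z → memPos B z ≡ true) (sym y≡x) Bx)))
    ... | yes refl | no y≢x rewrite ≡ᵇ-refl (toℕ x) | ≢⇒≡ᵇ-false (toℕ y) (toℕ x) y≢x | Bx = refl
    ... | no x≢t | yes refl rewrite ≡ᵇ-refl (toℕ y) | ≢⇒≡ᵇ-false (toℕ x) (toℕ y) x≢t | By = refl
    ... | no x≢t | no y≢t rewrite ≢⇒≡ᵇ-false (toℕ x) t x≢t | ≢⇒≡ᵇ-false (toℕ y) t y≢t with memPos B t
    ...   | true  = refl
    ...   | false = refl

  card<-before-both : ∀ t → ¬ toℕ x < t → ¬ toℕ y < t → card< exchanged t ≡ card< B t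
  card<-before-both t x≮t y≮t with card<-balance t
  ... | eq rewrite ≮⇒<ᵇ-false _ t x≮t | ≮⇒<ᵇ-false _ t y≮t = +-cancelʳ-≡ 0 _ _ eq

  card<-after-both : ∀ t → toℕ x < t → toℕ y < t → card< exchanged t ≡ card< B t
  card<-after-both t x<t y<t with card<-balance t
  ... | eq rewrite <⇒<ᵇ-true _ t x<t | <⇒<ᵇ-true _ t y<t = +-cancelʳ-≡ 1 _ _ eq

  card<-gains : ∀ t → ¬ toℕ x < t → toℕ y < t → card< exchanged t ≡ suc (card< B t)
  card<-gains t x≮t y<t with card<-balance t
  ... | eq rewrite ≮⇒<ᵇ-false _ t x≮t | <⇒<ᵇ-true _ t y<t =
    trans (sym (+-identityʳ _)) (trans eq (+-comm (card< B t) 1))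

  card<-loses : ∀ t → toℕ x < t → ¬ toℕ y < t → suc (card< exchanged t) ≡ card< B t
  card<-loses t x<t y≮t with card<-balance t
  ... | eq rewrite <⇒<ᵇ-true _ t x<t | ≮⇒<ᵇ-false _ t y≮t =
    trans (+-comm 1 _) (trans eq (+-identityʳ _))

sum-map-tabulate : ∀ {r s} (c : Fin r → Bool) (g : Fin s → Fin r) →
                   sum (map (λ a → if c a then 1 else 0) (tabulate g)) ≡ count (λ i → c (g i))
sum-map-tabulate {s = zero}  c g = refl
sum-map-tabulate {s = suc s} c g = cong (bit (c (g Fin.zero)) +_) (sum-map-tabulate c (λ i → g (Fin.suc i)))

any-tabulate⇒ : ∀ {r s} (p : Fin r → Bool) (g : Fin s → Fin r) → any p (tabulate g) ≡ true → ∃[ i ] (p (g i) ≡ true)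
any-tabulate⇒ {s = suc s} p g e with p (g Fin.zero) in eq
... | true  = Fin.zero , eq
... | false with i , e′ ← any-tabulate⇒ p (λ i → g (Fin.suc i)) e = Fin.suc i , e′

any-tabulate⇐ : ∀ {r s} (p : Fin r → Bool) (g : Fin s → Fin r) i → p (g i) ≡ true → any p (tabulate g) ≡ true
any-tabulate⇐ {s = suc s} p g Fin.zero    e rewrite e = refl
any-tabulate⇐ {s = suc s} p g (Fin.suc i) e rewrite any-tabulate⇐ p (λ i → g (Fin.suc i)) i e with p (g Fin.zero)
... | true  = refl
... | false = refl

OnAntidiagonals : ℕ → (ℕ → Point) → Set
OnAntidiagonals c π = ∀ t → proj₁ (π t) + proj₂ (π t) ≡ c + t

pathPt-onAntidiagonals : ∀ x y w → OnAntidiagonals (x + y) (pathPt (x , y) w)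
pathPt-onAntidiagonals x y w t = begin
  x + (t ∸ N) + (y + N)   ≡⟨ interchange x (t ∸ N) y N ⟩
  x + y + (t ∸ N + N)     ≡⟨ cong (x + y +_) (m∸n+n≡m (norths≤ w t)) ⟩
  x + y + t               ∎
  where
  open ≡-Reasoning
  N = norths w t

points-≡ : ∀ {c} (π ρ : ℕ → Point) → OnAntidiagonals c π → OnAntidiagonals c ρ →
           ∀ s t → π s ≡ ρ t → s ≡ t × proj₂ (π s) ≡ proj₂ (ρ t)
points-≡ {c} π ρ π-diag ρ-diag s t e =
  +-cancelˡ-≡ c s t (trans (sym (π-diag s)) (trans (cong (λ q → proj₁ q + proj₂ q) e) (ρ-diag t))) , cong proj₂ e

points-≡⇐ : ∀ {c} (π ρ : ℕ → Point) → OnAntidiagonals c π → OnAntidiagonals c ρ →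
            ∀ t → proj₂ (π t) ≡ proj₂ (ρ t) → π t ≡ ρ t
points-≡⇐ {c} π ρ π-diag ρ-diag t e with π t | ρ t | π-diag t | ρ-diag t
... | (x₁ , y₁) | (x₂ , y₂) | d₁ | d₂ rewrite e = cong (_, y₂) (+-cancelʳ-≡ y₂ x₁ x₂ (trans d₁ (sym d₂)))

module Presentation (m r : ℕ) (𝓘 : Fin r → Interval (m + r)) (antichain : Setup.Antichain m r 𝓘) where
  open Setup m r 𝓘 public

  firstOf lastOf : Fin r → ℕ
  firstOf a = firstPos (𝓘 a)
  lastOf  a = lastPos (𝓘 a)

  wrapping : Fin r → Bool
  wrapping a = wraps (𝓘 a)

  firstOf<n : ∀ a → firstOf a < n
  firstOf<n a = firstPos<n (𝓘 a)

  lastOf<n : ∀ a → lastOf a < n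
  lastOf<n a = lastPos<n (𝓘 a)

  ⊆I⇒≡ : ∀ a b → 𝓘 a ⊆I 𝓘 b → a ≡ b
  ⊆I⇒≡ a b sub with a Fin.≟ b
  ... | yes a≡b = a≡b
  ... | no a≢b  = ⊥-elim (antichain a b a≢b sub)

  first-injective : ∀ a b → firstOf a ≡ firstOf b → a ≡ b
  first-injective a b e with ≤-total (Interval.len (𝓘 a)) (Interval.len (𝓘 b))
  ... | inj₁ la≤lb = ⊆I⇒≡ a b (⊆I-same-first (𝓘 a) (𝓘 b) e la≤lb)
  ... | inj₂ lb≤la = sym (⊆I⇒≡ b a (⊆I-same-first (𝓘 b) (𝓘 a) (sym e) lb≤la))

  wrapping-distinct : ∀ a b → wrapping a ≡ true → wrapping b ≡ false → a ≢ b
  wrapping-distinct a b wa wb refl = false≢true (trans (sym wb) wa)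

  last-injective : ∀ a b → lastOf a ≡ lastOf b → a ≡ b
  last-injective a b e = by-wrapping (wrapping a) (wrapping b) refl refl
    where
    by-wrapping : ∀ x y → wrapping a ≡ x → wrapping b ≡ y → a ≡ b
    by-wrapping false false wa wb with ≤-total (firstOf a) (firstOf b)
    ... | inj₁ fa≤fb = sym (⊆I⇒≡ b a (⊆I-nonwrapping (𝓘 b) (𝓘 a) wb wa fa≤fb (≤-reflexive (sym e))))
    ... | inj₂ fb≤fa = ⊆I⇒≡ a b (⊆I-nonwrapping (𝓘 a) (𝓘 b) wa wb fb≤fa (≤-reflexive e))
    by-wrapping true true wa wb with ≤-total (firstOf a) (firstOf b)
    ... | inj₁ fa≤fb = sym (⊆I⇒≡ b a (⊆I-wrapping (𝓘 b) (𝓘 a) wb wa fa≤fb (≤-reflexive (sym e))))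
    ... | inj₂ fb≤fa = ⊆I⇒≡ a b (⊆I-wrapping (𝓘 a) (𝓘 b) wa wb fb≤fa (≤-reflexive e))
    by-wrapping true false wa wb = sym (⊆I⇒≡ b a (⊆I-into-wrapping (𝓘 b) (𝓘 a) wb wa (inj₂ (≤-reflexive (sym e)))))
    by-wrapping false true wa wb = ⊆I⇒≡ a b (⊆I-into-wrapping (𝓘 a) (𝓘 b) wa wb (inj₂ (≤-reflexive e)))

  nonwrapping-first<wrapping-first : ∀ a b → wrapping a ≡ true → wrapping b ≡ false → firstOf b < firstOf a
  nonwrapping-first<wrapping-first a b wa wb with firstOf a ≤? firstOf b
  ... | yes fa≤fb = ⊥-elim (wrapping-distinct a b wa wb (sym (⊆I⇒≡ b a (⊆I-into-wrapping (𝓘 b) (𝓘 a) wb wa (inj₁ fa≤fb)))))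
  ... | no fa≰fb  = ≰⇒> fa≰fb

  wrapping-last<nonwrapping-last : ∀ a b → wrapping a ≡ true → wrapping b ≡ false → lastOf a < lastOf b
  wrapping-last<nonwrapping-last a b wa wb with lastOf b ≤? lastOf a
  ... | yes lb≤la = ⊥-elim (wrapping-distinct a b wa wb (sym (⊆I⇒≡ b a (⊆I-into-wrapping (𝓘 b) (𝓘 a) wb wa (inj₂ lb≤la)))))
  ... | no lb≰la  = ≰⇒> lb≰la

  nonwrapping-last-mono : ∀ a b → wrapping a ≡ false → wrapping b ≡ false → firstOf b ≤ firstOf a → lastOf b ≤ lastOf a
  nonwrapping-last-mono a b wa wb fb≤fa with lastOf b ≤? lastOf a
  ... | yes lb≤la = lb≤la
  ... | no lb≰la with refl ← ⊆I⇒≡ a b (⊆I-nonwrapping (𝓘 a) (𝓘 b) wa wb fb≤fa (<⇒≤ (≰⇒> lb≰la))) = ≤-refl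

  wrapping-last-mono : ∀ a b → wrapping a ≡ true → wrapping b ≡ true → firstOf b ≤ firstOf a → lastOf b ≤ lastOf a
  wrapping-last-mono a b wa wb fb≤fa with lastOf b ≤? lastOf a
  ... | yes lb≤la = lb≤la
  ... | no lb≰la with refl ← ⊆I⇒≡ a b (⊆I-wrapping (𝓘 a) (𝓘 b) wa wb fb≤fa (<⇒≤ (≰⇒> lb≰la))) = ≤-refl

  #wrapping : ℕ
  #wrapping = count wrapping

  k≡1+#wrapping : k ≡ suc #wrapping
  k≡1+#wrapping = cong suc (trans (sum-map-tabulate {r} {r} (λ a → memᵇ (𝓘 a) 0 ∧ not (firstOf a ≡ᵇ 0)) (λ a → a))
                                   (count-cong _ _ (λ a → covers0-not-first≡wraps (𝓘 a))))

  northsP northsQ : ℕ → ℕ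
  northsP = norths wordP
  northsQ = norths wordQ

  norths≡count-marked : (w : ℕ → Bool) (g : Fin r → ℕ) → (∀ a → g a < n) → (∀ a b → g a ≡ g b → a ≡ b) →
                        (∀ a → w (suc (g a)) ≡ true) → (∀ j → w (suc j) ≡ true → ∃[ a ] (g a ≡ j)) →
                        ∀ t → t ≤ n → norths w t ≡ count (λ a → g a <ᵇ t)
  norths≡count-marked w g g<n g-inj marked marked⇒ t t≤n = ≤-antisym
    (≤-trans (≤-reflexive norths≡)
      (≤-trans (count-surjective-image (λ _ → true) g q n g<n (λ j _ e → let a , ga≡j = marked⇒ j (∧-elimʳ _ _ e) in a , refl , ga≡j))
               (≤-reflexive count-q≡)))
    (≤-trans (≤-reflexive (sym count-q≡))
      (≤-trans (count-injective-image (λ _ → true) g q n g<n (λ a b _ _ → g-inj a b)) (≤-reflexive (sym norths≡))))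
    where
    q : ℕ → Bool
    q j = (j <ᵇ t) ∧ w (suc j)
    norths≡ : norths w t ≡ sumTo (λ j → bit (q j)) n
    norths≡ = trans (norths≡sumTo w t) (sym (sumTo-prefix (λ j → w (suc j)) t n t≤n))
    count-q≡ : count (λ a → q (g a)) ≡ count (λ a → g a <ᵇ t)
    count-q≡ = count-cong _ _ (λ a → trans (cong ((g a <ᵇ t) ∧_) (marked a)) (∧-identityʳ _))

  northsP≡count : ∀ t → t ≤ n → northsP t ≡ count (λ a → lastOf a <ᵇ t)
  northsP≡count = norths≡count-marked wordP lastOf lastOf<n last-injective
    (λ a → any-tabulate⇐ _ (λ x → x) a (isLast⇐ (𝓘 a)))
    (λ j e → let a , isLast = any-tabulate⇒ _ (λ x → x) e in a , sym (isLast⇒ (𝓘 a) j isLast))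

  northsQ≡count : ∀ t → t ≤ n → northsQ t ≡ count (λ a → firstOf a <ᵇ t)
  northsQ≡count = norths≡count-marked wordQ firstOf firstOf<n first-injective
    (λ a → any-tabulate⇐ _ (λ x → x) a (isFirst⇐ (𝓘 a)))
    (λ j e → let a , isFirst = any-tabulate⇒ _ (λ x → x) e in a , sym (isFirst⇒ (𝓘 a) j isFirst))

  count-below-n≡r : ∀ (g : Fin r → ℕ) → (∀ a → g a < n) → count (λ a → g a <ᵇ n) ≡ r
  count-below-n≡r g g<n = trans (count-cong _ _ (λ a → <⇒<ᵇ-true _ _ (g<n a))) count-all

  northsP-end : northsP n ≡ r
  northsP-end = trans (northsP≡count n ≤-refl) (count-below-n≡r lastOf lastOf<n)

  northsQ-end : northsQ n ≡ r
  northsQ-end = trans (northsQ≡count n ≤-refl) (count-below-n≡r firstOf firstOf<n)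

  -- Π(X, p_{h+1}) lies in the region iff its height h + card< X t stays between those of P and Q.
  Between : ℕ → (ℕ → ℕ) → Set
  Between h c = ∀ t → t ≤ n → northsP t ≤ h + c t × h + c t ≤ #wrapping + northsQ t

  record Matching (X : Subset n) : Set where
    field
      match          : Fin r → ℕ
      match<n        : ∀ a → match a < n
      match-covers   : ∀ a → Covers (𝓘 a) (match a)
      match-injective : ∀ a b → match a ≡ match b → a ≡ b
      match-∈        : ∀ a → memPos X (match a) ≡ true
      match-onto     : ∀ j → memPos X j ≡ true → ∃[ a ] (match a ≡ j)

    card<≡count-matched : ∀ t → t ≤ n → card< X t ≡ count (λ a → match a <ᵇ t)
    card<≡count-matched t t≤n = ≤-antisym
      (≤-trans (≤-reflexive (card<≡sumTo X t n t≤n))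
        (≤-trans (count-surjective-image (λ _ → true) match q n match<n
                   (λ j _ e → let a , ma≡j = match-onto j (∧-elimʳ _ _ e) in a , refl , ma≡j))
                 (≤-reflexive count-q≡)))
      (≤-trans (≤-reflexive (sym count-q≡))
        (≤-trans (count-injective-image (λ _ → true) match q n match<n (λ a b _ _ → match-injective a b))
                 (≤-reflexive (sym (card<≡sumTo X t n t≤n)))))
      where
      q : ℕ → Bool
      q j = (j <ᵇ t) ∧ memPos X j
      count-q≡ : count (λ a → q (match a)) ≡ count (λ a → match a <ᵇ t)
      count-q≡ = count-cong _ _ (λ a → trans (cong ((match a <ᵇ t) ∧_) (match-∈ a)) (∧-identityʳ _))

  module _ {X : Subset n} (ind : Independent X) where
    private
      used  = proj₁ ind
      rep   = proj₁ (proj₂ ind)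
      rep-covers   = proj₁ (proj₂ (proj₂ ind))
      rep-injective = proj₁ (proj₂ (proj₂ (proj₂ ind)))
      rep-onto     = λ j → proj₁ (proj₂ (proj₂ (proj₂ (proj₂ ind))) j)
      rep-∈        = λ j → proj₂ (proj₂ (proj₂ (proj₂ (proj₂ ind))) j)
      isUsed : Fin r → Bool
      isUsed a = memPos used (toℕ a)

      card<≤used : card< X n ≤ count isUsed
      card<≤used = ≤-trans (≤-reflexive (norths≡sumTo _ n))
        (≤-trans (count-surjective-image isUsed (toℕ ∘′ rep) (memPos X) n (λ a → Fin.toℕ<n (rep a)) preimage)
                 (count-mono _ isUsed (λ a e → ∧-elimˡ _ _ e)))
        where
        preimage : ∀ j → j < n → memPos X j ≡ true → ∃[ a ] (isUsed a ≡ true × toℕ (rep a) ≡ j)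
        preimage j j<n Xj =
          let a , a∈used , rep≡ = rep-onto (Fin.fromℕ< j<n) (memPos⇒∈ X _ (trans (memPos-fromℕ< X j<n) Xj))
          in a , ∈⇒memPos used a∈used , trans (cong toℕ rep≡) (Fin.toℕ-fromℕ< j<n)

    independent-size≤ : card< X n ≤ r
    independent-size≤ = ≤-trans card<≤used (count≤ _)

    independent⇒matching : card< X n ≡ r → Matching X
    independent⇒matching |X|≡r = record
      { match           = toℕ ∘′ rep
      ; match<n         = λ a → Fin.toℕ<n (rep a)
      ; match-covers    = λ a → rep-covers a (all-used a)
      ; match-injective = λ a b e → rep-injective a b (all-used a) (all-used b) (Fin.toℕ-injective e)
      ; match-∈         = λ a → ∈⇒memPos X (rep-∈ (rep a) a (all-used a))
      ; match-onto      = λ j Xj → let j<n = memPos⇒< X j Xj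
                                       a , _ , rep≡ = rep-onto (Fin.fromℕ< j<n) (memPos⇒∈ X _ (trans (memPos-fromℕ< X j<n) Xj))
                                   in a , trans (cong toℕ rep≡) (Fin.toℕ-fromℕ< j<n)
      }
      where
      all-used : ∀ a → a ∈ used
      all-used a = memPos⇒∈ used a (count-full isUsed (≤-antisym (count≤ _) (subst (_≤ count isUsed) |X|≡r card<≤used)) a)

  matching⇒independent : ∀ {X} → Matching X → Independent X
  matching⇒independent {X} μ = Subset.⊤ , rep , (λ a _ → subst (Covers (𝓘 a)) (sym (toℕ-rep a)) (match-covers a))
                             , (λ a b _ _ e → match-injective a b (trans (sym (toℕ-rep a)) (trans (cong toℕ e) (toℕ-rep b))))
                             , λ j → onto j , λ a _ → memPos⇒∈ X (rep a) (trans (cong (memPos X) (toℕ-rep a)) (match-∈ a))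
    where
    open Matching μ
    rep : Fin r → Fin n
    rep a = Fin.fromℕ< (match<n a)
    toℕ-rep : ∀ a → toℕ (rep a) ≡ match a
    toℕ-rep a = Fin.toℕ-fromℕ< (match<n a)
    onto : ∀ j → j ∈ X → ∃[ a ] (a ∈ Subset.⊤ × rep a ≡ j)
    onto j j∈X = let a , ma≡j = match-onto (toℕ j) (∈⇒memPos X j∈X)
                 in a , Subset.∈⊤ , Fin.toℕ-injective (trans (toℕ-rep a) ma≡j)

  module _ {X : Subset n} (μ : Matching X) where
    open Matching μ

    -- The start p_{h+1} of the path: h counts the wrapping intervals matched at or after their first element.
    matchedLate matchedEarly : Fin r → Bool
    matchedLate  a = wrapping a ∧ (firstOf a ≤ᵇ match a)
    matchedEarly a = wrapping a ∧ not (firstOf a ≤ᵇ match a)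

    matchedLate≤#wrapping : count matchedLate ≤ #wrapping
    matchedLate≤#wrapping = count-mono _ wrapping (λ a e → ∧-elimˡ _ _ e)

    last<⇒late-or-matched< : ∀ t a → (lastOf a <ᵇ t) ≡ true → matchedLate a ≡ true ⊎ (match a <ᵇ t) ≡ true
    last<⇒late-or-matched< t a e = by-wrapping (wrapping a) refl
      where
      by-wrapping : ∀ b → wrapping a ≡ b → matchedLate a ≡ true ⊎ (match a <ᵇ t) ≡ true
      by-wrapping false w = inj₂ (<⇒<ᵇ-true _ t (≤-<-trans (proj₂ (nonwrapping-covers⇒ (𝓘 a) _ (match<n a) w (match-covers a)))
                                                              (<ᵇ-sound (lastOf a) t e)))
      by-wrapping true w with firstOf a ≤? match a | wrapping-covers⇒ (𝓘 a) _ (match<n a) w (match-covers a)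
      ... | yes f≤m | _        = inj₁ (∧-intro w (≤⇒≤ᵇ-true _ _ f≤m))
      ... | no f≰m  | inj₁ f≤m = ⊥-elim (f≰m f≤m)
      ... | no f≰m  | inj₂ m≤l = inj₂ (<⇒<ᵇ-true _ t (≤-<-trans m≤l (<ᵇ-sound (lastOf a) t e)))

    matched<⇒first<-or-early : ∀ t a → (match a <ᵇ t) ≡ true → (firstOf a <ᵇ t) ≡ true ⊎ matchedEarly a ≡ true
    matched<⇒first<-or-early t a e with firstOf a ≤? match a
    ... | yes f≤m = inj₁ (<⇒<ᵇ-true _ t (≤-<-trans f≤m (<ᵇ-sound _ t e)))
    ... | no f≰m  = inj₂ (by-wrapping (wrapping a) refl)
      where
      by-wrapping : ∀ b → wrapping a ≡ b → matchedEarly a ≡ true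
      by-wrapping false w = ⊥-elim (f≰m (proj₁ (nonwrapping-covers⇒ (𝓘 a) _ (match<n a) w (match-covers a))))
      by-wrapping true  w = ∧-intro w (cong not (>⇒≤ᵇ-false _ _ (≰⇒> f≰m)))

    matching⇒between : Between (count matchedLate) (card< X)
    matching⇒between t t≤n = lower , upper
      where
      h = count matchedLate
      lower : northsP t ≤ h + card< X t
      lower = begin
        northsP t                                        ≡⟨ northsP≡count t t≤n ⟩
        count (λ a → lastOf a <ᵇ t)                      ≤⟨ count-∪ _ matchedLate _ (last<⇒late-or-matched< t) ⟩
        h + count (λ a → match a <ᵇ t)                   ≡⟨ cong (h +_) (card<≡count-matched t t≤n) ⟨
        h + card< X t                                    ∎
        where open ≤-Reasoning
      upper : h + card< X t ≤ #wrapping + northsQ t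
      upper = begin
        h + card< X t                                    ≡⟨ cong (h +_) (card<≡count-matched t t≤n) ⟩
        h + count (λ a → match a <ᵇ t)                   ≤⟨ +-monoʳ-≤ h (count-∪ _ _ matchedEarly (matched<⇒first<-or-early t)) ⟩
        h + (F + count matchedEarly)                     ≡⟨ cong (h +_) (+-comm F _) ⟩
        h + (count matchedEarly + F)                     ≡⟨ +-assoc h _ F ⟨
        (h + count matchedEarly) + F                     ≡⟨ cong (_+ F) (count-split wrapping (λ a → firstOf a ≤ᵇ match a)) ⟨
        #wrapping + F                                    ≡⟨ cong (#wrapping +_) (northsQ≡count t t≤n) ⟨
        #wrapping + northsQ t                            ∎
        where
        open ≤-Reasoning
        F = count (λ a → firstOf a <ᵇ t)

  firstsBelow : (Fin r → Bool) → ℕ → ℕ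
  firstsBelow P T = count (λ c → P c ∧ (firstOf c <ᵇ T))

  rankIn : (Fin r → Bool) → Fin r → ℕ
  rankIn P a = firstsBelow P (firstOf a)

  firstsBelow-step : ∀ P T → firstsBelow P (suc T) ≤ firstsBelow P T + count (λ c → P c ∧ (firstOf c ≡ᵇ T))
  firstsBelow-step P T = count-∪ _ _ _ below-or-at
    where
    below-or-at : ∀ c → (P c ∧ (firstOf c <ᵇ suc T)) ≡ true → (P c ∧ (firstOf c <ᵇ T)) ≡ true ⊎ (P c ∧ (firstOf c ≡ᵇ T)) ≡ true
    below-or-at c e with m<1+n⇒m<n∨m≡n (<ᵇ-sound (firstOf c) (suc T) (∧-elimʳ (P c) _ e))
    ... | inj₁ f<T  = inj₁ (∧-intro (∧-elimˡ _ _ e) (<⇒<ᵇ-true _ _ f<T))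
    ... | inj₂ refl = inj₂ (∧-intro (∧-elimˡ _ _ e) (≡ᵇ-refl (firstOf c)))

  firstsBelow-unitSteps : ∀ P → UnitSteps (firstsBelow P)
  firstsBelow-unitSteps P = count-none _ (λ c → ∧-zeroʳ (P c)) , λ T →
    ≤-trans (firstsBelow-step P T) (≤-trans (+-monoʳ-≤ _ (at-most-one T)) (≤-reflexive (+-comm _ 1)))
    where
    at-most-one : ∀ T → count (λ c → P c ∧ (firstOf c ≡ᵇ T)) ≤ 1
    at-most-one T = count≤1 _ (λ a b x y → first-injective a b
                      (trans (≡ᵇ-sound _ T (∧-elimʳ (P a) _ x)) (sym (≡ᵇ-sound _ T (∧-elimʳ (P b) _ y)))))

  firstsBelow-n : ∀ P → firstsBelow P n ≡ count P
  firstsBelow-n P = count-cong _ _ (λ c → trans (cong (P c ∧_) (<⇒<ᵇ-true _ _ (firstOf<n c))) (∧-identityʳ _))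

  rankIn<count : ∀ P a → P a ≡ true → rankIn P a < count P
  rankIn<count P a Pa = count-< _ P (λ c e → ∧-elimˡ _ _ e) a (trans (cong (P a ∧_) (<ᵇ-irrefl (firstOf a))) (∧-zeroʳ _)) Pa

  1+rankIn≤ : ∀ P a → P a ≡ true → suc (rankIn P a) ≤ firstsBelow P (suc (firstOf a))
  1+rankIn≤ P a Pa = count-< _ _
    (λ c e → ∧-intro (∧-elimˡ (P c) _ e) (<⇒<ᵇ-true (firstOf c) (suc (firstOf a)) (m<n⇒m<1+n (<ᵇ-sound _ (firstOf a) (∧-elimʳ (P c) _ e)))))
    a (trans (cong (P a ∧_) (<ᵇ-irrefl (firstOf a))) (∧-zeroʳ _)) (∧-intro Pa (<⇒<ᵇ-true (firstOf a) _ ≤-refl))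

  rankIn-< : ∀ P a b → P a ≡ true → firstOf a < firstOf b → rankIn P a < rankIn P b
  rankIn-< P a b Pa fa<fb = <-≤-trans (1+rankIn≤ P a Pa) (count-mono _ _ below)
    where
    below : ∀ c → (P c ∧ (firstOf c <ᵇ suc (firstOf a))) ≡ true → (P c ∧ (firstOf c <ᵇ firstOf b)) ≡ true
    below c e = ∧-intro (∧-elimˡ _ _ e) (<⇒<ᵇ-true _ _ (<-≤-trans (<ᵇ-sound _ _ (∧-elimʳ (P c) _ e)) fa<fb))

  rankIn-injective : ∀ P a b → P a ≡ true → P b ≡ true → rankIn P a ≡ rankIn P b → a ≡ b
  rankIn-injective P a b Pa Pb e with <-cmp (firstOf a) (firstOf b)
  ... | tri< fa<fb _ _ = ⊥-elim (<-irrefl e (rankIn-< P a b Pa fa<fb))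
  ... | tri≈ _ fa≡fb _ = first-injective a b fa≡fb
  ... | tri> _ _ fb<fa = ⊥-elim (<-irrefl (sym e) (rankIn-< P b a Pb fb<fa))

  rankIn-onto : ∀ P j → j < count P → ∃[ b ] (P b ≡ true × rankIn P b ≡ j)
  rankIn-onto P j j<#P
    with T , _ , below≡j , below+1≡1+j ← unitSteps-cross (firstsBelow P) (firstsBelow-unitSteps P) n j (subst (j <_) (sym (firstsBelow-n P)) j<#P) =
    let atT = count (λ c → P c ∧ (firstOf c ≡ᵇ T))
        step : suc j ≤ j + atT
        step = subst (λ z → suc j ≤ z + atT) below≡j (subst (_≤ firstsBelow P T + atT) below+1≡1+j (firstsBelow-step P T))
        b , Pb∧fb≡T = count-witness _ (+-cancelˡ-≤ j 1 atT (subst (_≤ j + atT) (+-comm 1 j) step))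
    in b , ∧-elimˡ (P b) _ Pb∧fb≡T , trans (cong (firstsBelow P) (≡ᵇ-sound (firstOf b) T (∧-elimʳ (P b) _ Pb∧fb≡T))) below≡j

  -- From the bounds back to a matching: the wrapping intervals with first position below τ (h of them)
  -- take the last h elements of X, inside their tails; the other wrapping intervals take the first ones,
  -- inside their heads; the non-wrapping intervals take those in between.  Each block goes in order of
  -- first positions.
  module Construction {X : Subset n} (|X|≡r : card< X n ≡ r) (h : ℕ) (h≤#wrapping : h ≤ #wrapping)
                      (between : Between h (card< X)) where

    τ-exists : ∃[ τ ] (τ ≤ n × firstsBelow wrapping τ ≡ h)
    τ-exists = unitSteps-hit (firstsBelow wrapping) (firstsBelow-unitSteps wrapping) n h
                             (subst (h ≤_) (sym (firstsBelow-n wrapping)) h≤#wrapping)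

    τ : ℕ
    τ = proj₁ τ-exists

    late early plain : Fin r → Bool
    late  a = wrapping a ∧ (firstOf a <ᵇ τ)
    early a = wrapping a ∧ not (firstOf a <ᵇ τ)
    plain a = not (wrapping a)

    #late≡h : count late ≡ h
    #late≡h = proj₂ (proj₂ τ-exists)

    #early #plain : ℕ
    #early = count early
    #plain = count plain

    #wrapping≡ : #wrapping ≡ h + #early
    #wrapping≡ = trans (count-split wrapping (λ a → firstOf a <ᵇ τ)) (cong (_+ #early) #late≡h)

    r≡ : #early + #plain + h ≡ r
    r≡ = begin
      #early + #plain + h   ≡⟨ +-comm (#early + #plain) h ⟩
      h + (#early + #plain) ≡⟨ +-assoc h #early #plain ⟨
      h + #early + #plain   ≡⟨ cong (_+ #plain) #wrapping≡ ⟨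
      #wrapping + #plain    ≡⟨ count-split (λ _ → true) wrapping ⟨
      count {r} (λ _ → true) ≡⟨ count-all ⟩
      r                     ∎
      where open ≡-Reasoning

    data Class (a : Fin r) : Set where
      isEarly : wrapping a ≡ true → (firstOf a <ᵇ τ) ≡ false → Class a
      isPlain : wrapping a ≡ false → Class a
      isLate  : wrapping a ≡ true → (firstOf a <ᵇ τ) ≡ true → Class a

    classify : ∀ a → Class a
    classify a with wrapping a in w | firstOf a <ᵇ τ in f
    ... | true  | false = isEarly w f
    ... | true  | true  = isLate w f
    ... | false | _     = isPlain w

    slotOf : ∀ {a} → Class a → ℕ
    slotOf {a} (isEarly _ _) = rankIn early a
    slotOf {a} (isPlain _)   = #early + rankIn plain a
    slotOf {a} (isLate _ _)  = #early + #plain + rankIn late a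

    slot : Fin r → ℕ
    slot a = slotOf (classify a)

    #early+#plain≤r : #early + #plain ≤ r
    #early+#plain≤r = subst (#early + #plain ≤_) r≡ (m≤m+n _ h)

    early-slot< : ∀ {a} w f → slotOf {a} (isEarly w f) < #early
    early-slot< {a} w f = rankIn<count early a (∧-intro w (cong not f))

    plain-slot< : ∀ {a} w → slotOf {a} (isPlain w) < #early + #plain
    plain-slot< {a} w = +-monoʳ-< #early (rankIn<count plain a (cong not w))

    slotOf<r : ∀ {a} (c : Class a) → slotOf c < r
    slotOf<r (isEarly w f) = <-≤-trans (early-slot< w f) (≤-trans (m≤m+n _ #plain) #early+#plain≤r)
    slotOf<r (isPlain w)   = <-≤-trans (plain-slot< w) #early+#plain≤r
    slotOf<r {a} (isLate w f) = subst (#early + #plain + rankIn late a <_) r≡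
      (+-monoʳ-< (#early + #plain) (subst (rankIn late a <_) #late≡h (rankIn<count late a (∧-intro w f))))

    separated : ∀ {x y} s → x < s → s ≤ y → x ≢ y
    separated s x<s s≤y refl = <-irrefl refl (<-≤-trans x<s s≤y)

    slotOf-injective : ∀ {a b} (ca : Class a) (cb : Class b) → slotOf ca ≡ slotOf cb → a ≡ b
    slotOf-injective {a} {b} (isEarly wa fa) (isEarly wb fb) e =
      rankIn-injective early a b (∧-intro wa (cong not fa)) (∧-intro wb (cong not fb)) e
    slotOf-injective {a} {b} (isPlain wa) (isPlain wb) e =
      rankIn-injective plain a b (cong not wa) (cong not wb) (+-cancelˡ-≡ #early _ _ e)
    slotOf-injective {a} {b} (isLate wa fa) (isLate wb fb) e =
      rankIn-injective late a b (∧-intro wa fa) (∧-intro wb fb) (+-cancelˡ-≡ (#early + #plain) _ _ e)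
    slotOf-injective (isEarly wa fa) (isPlain wb)   e = ⊥-elim (separated #early (early-slot< wa fa) (m≤m+n _ _) e)
    slotOf-injective (isPlain wa)   (isEarly wb fb) e = ⊥-elim (separated #early (early-slot< wb fb) (m≤m+n _ _) (sym e))
    slotOf-injective (isEarly wa fa) (isLate wb fb) e = ⊥-elim (separated #early (early-slot< wa fa) (≤-trans (m≤m+n _ #plain) (m≤m+n _ _)) e)
    slotOf-injective (isLate wa fa) (isEarly wb fb) e = ⊥-elim (separated #early (early-slot< wb fb) (≤-trans (m≤m+n _ #plain) (m≤m+n _ _)) (sym e))
    slotOf-injective (isPlain wa)   (isLate wb fb)  e = ⊥-elim (separated (#early + #plain) (plain-slot< wa) (m≤m+n _ _) e)
    slotOf-injective (isLate wa fa) (isPlain wb)    e = ⊥-elim (separated (#early + #plain) (plain-slot< wb) (m≤m+n _ _) (sym e))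

    slot-early : ∀ b → early b ≡ true → slot b ≡ rankIn early b
    slot-early b e with classify b
    ... | isEarly _ _ = refl
    ... | isPlain w   = ⊥-elim (false≢true (trans (sym w) (∧-elimˡ _ _ e)))
    ... | isLate _ f  = ⊥-elim (false≢true (trans (sym (cong not f)) (∧-elimʳ _ _ e)))

    slot-plain : ∀ b → plain b ≡ true → slot b ≡ #early + rankIn plain b
    slot-plain b e with classify b
    ... | isEarly w _ = ⊥-elim (false≢true (trans (sym (cong not w)) e))
    ... | isPlain _   = refl
    ... | isLate w _  = ⊥-elim (false≢true (trans (sym (cong not w)) e))

    slot-late : ∀ b → late b ≡ true → slot b ≡ #early + #plain + rankIn late b
    slot-late b e with classify b
    ... | isEarly _ f = ⊥-elim (false≢true (trans (sym f) (∧-elimʳ _ _ e)))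
    ... | isPlain w   = ⊥-elim (false≢true (trans (sym w) (∧-elimˡ _ _ e)))
    ... | isLate _ _  = refl

    slot-onto : ∀ s → s < r → ∃[ a ] (slot a ≡ s)
    slot-onto s s<r with s <? #early | s ∸ #early <? #plain
    ... | yes s<E | _ = let b , Eb , rank≡s = rankIn-onto early s s<E in b , trans (slot-early b Eb) rank≡s
    ... | no s≮E | yes s-E<P =
      let b , Pb , rank≡ = rankIn-onto plain (s ∸ #early) s-E<P
      in b , trans (slot-plain b Pb) (trans (cong (#early +_) rank≡) (m+[n∸m]≡n (≮⇒≥ s≮E)))
    ... | no s≮E | no s-E≮P =
      let E+P≤s = ≤-trans (+-monoʳ-≤ #early (≮⇒≥ s-E≮P)) (≤-reflexive (m+[n∸m]≡n (≮⇒≥ s≮E)))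
          b , Lb , rank≡ = rankIn-onto late (s ∸ (#early + #plain))
                             (subst (s ∸ (#early + #plain) <_) (sym #late≡h) (<+⇒∸< E+P≤s (subst (s <_) (sym r≡) s<r)))
      in b , trans (slot-late b Lb) (trans (cong (#early + #plain +_) rank≡) (m+[n∸m]≡n E+P≤s))

    slot-injective : ∀ a b → slot a ≡ slot b → a ≡ b
    slot-injective a b = slotOf-injective (classify a) (classify b)

    slot<r : ∀ a → slot a < r
    slot<r a = slotOf<r (classify a)

    elementAt : ∀ s → s < r → ∃[ e ] (e < n × memPos X e ≡ true × card< X e ≡ s)
    elementAt s s<r = element-of-rank X s (subst (s <_) (sym |X|≡r) s<r)

    match : Fin r → ℕ
    match a = proj₁ (elementAt (slot a) (slot<r a))

    match<n : ∀ a → match a < n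
    match<n a = proj₁ (proj₂ (elementAt (slot a) (slot<r a)))

    match-∈ : ∀ a → memPos X (match a) ≡ true
    match-∈ a = proj₁ (proj₂ (proj₂ (elementAt (slot a) (slot<r a))))

    card<-match : ∀ a → card< X (match a) ≡ slot a
    card<-match a = proj₂ (proj₂ (proj₂ (elementAt (slot a) (slot<r a))))

    first≤match : ∀ a y → northsQ (firstOf a) ≤ y → #early + y ≤ slot a → firstOf a ≤ match a
    first≤match a y Q≤y E+y≤slot = rank-mono⇒≤ X (match a) (firstOf a) (match-∈ a)
      (subst (card< X (firstOf a) ≤_) (sym (card<-match a)) (≤-trans card<≤ E+y≤slot))
      where
      t≤n = <⇒≤ (firstOf<n a)
      card<≤ : card< X (firstOf a) ≤ #early + y
      card<≤ = +-cancelˡ-≤ h _ _ (begin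
        h + card< X (firstOf a)          ≤⟨ proj₂ (between (firstOf a) t≤n) ⟩
        #wrapping + northsQ (firstOf a)  ≤⟨ +-monoʳ-≤ #wrapping Q≤y ⟩
        #wrapping + y                    ≡⟨ cong (_+ y) #wrapping≡ ⟩
        h + #early + y                   ≡⟨ +-assoc h #early y ⟩
        h + (#early + y)                 ∎)
        where open ≤-Reasoning

    match≤last : ∀ a → h + suc (slot a) ≤ count (λ c → lastOf c <ᵇ suc (lastOf a)) → match a ≤ lastOf a
    match≤last a bound = rank<⇒≤ X (match a) (lastOf a)
      (subst (_< card< X (suc (lastOf a))) (sym (card<-match a)) (+-cancelˡ-≤ h _ _ (begin
        h + suc (slot a)                              ≤⟨ bound ⟩
        count (λ c → lastOf c <ᵇ suc (lastOf a))      ≡⟨ northsP≡count (suc (lastOf a)) (lastOf<n a) ⟨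
        northsP (suc (lastOf a))                      ≤⟨ proj₁ (between (suc (lastOf a)) (lastOf<n a)) ⟩
        h + card< X (suc (lastOf a))                  ∎)))
      where open ≤-Reasoning

    last≤⇐first≤ : ∀ a (P : Fin r → Bool) → (∀ c → P c ≡ true → firstOf c ≤ firstOf a → lastOf c ≤ lastOf a) →
                   ∀ c → (P c ∧ (firstOf c <ᵇ suc (firstOf a))) ≡ true → (lastOf c <ᵇ suc (lastOf a)) ≡ true
    last≤⇐first≤ a P mono c e =
      <⇒<ᵇ-true _ _ (s≤s (mono c (∧-elimˡ (P c) _ e) (≤-pred (<ᵇ-sound (firstOf c) _ (∧-elimʳ (P c) _ e)))))

    covers-early : ∀ a → wrapping a ≡ true → (firstOf a <ᵇ τ) ≡ false → Covers (𝓘 a) (match a)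
    covers-early a w f = wrapping-covers-head (𝓘 a) (match a) w (match≤last a (begin
      h + suc (slot a)                                            ≡⟨ cong (λ s → h + suc s) (slot-early a Ea) ⟩
      h + suc (rankIn early a)                                    ≤⟨ +-mono-≤ (≤-reflexive (sym #late≡h)) (1+rankIn≤ early a Ea) ⟩
      count late + firstsBelow early (suc (firstOf a))            ≤⟨ count-disjoint _ late _ late-below early-below late≠early ⟩
      firstsBelow wrapping (suc (firstOf a))                      ≤⟨ count-mono _ _ (last≤⇐first≤ a wrapping (λ c wc → wrapping-last-mono a c w wc)) ⟩
      count (λ c → lastOf c <ᵇ suc (lastOf a))                    ∎))
      where
      open ≤-Reasoning
      Ea = ∧-intro w (cong not f)
      late-below : ∀ c → late c ≡ true → (wrapping c ∧ (firstOf c <ᵇ suc (firstOf a))) ≡ true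
      late-below c e = ∧-intro (∧-elimˡ _ _ e)
        (<⇒<ᵇ-true _ _ (m<n⇒m<1+n (<-≤-trans (<ᵇ-sound _ τ (∧-elimʳ (wrapping c) _ e)) (<ᵇ-false⇒≥ (firstOf a) τ f))))
      early-below : ∀ c → (early c ∧ (firstOf c <ᵇ suc (firstOf a))) ≡ true → (wrapping c ∧ (firstOf c <ᵇ suc (firstOf a))) ≡ true
      early-below c e = ∧-intro (∧-elimˡ _ _ (∧-elimˡ (early c) _ e)) (∧-elimʳ (early c) _ e)
      late≠early : ∀ c → late c ≡ true → (early c ∧ (firstOf c <ᵇ suc (firstOf a))) ≢ true
      late≠early c e e′ = false≢true (trans (sym (cong not (∧-elimʳ (wrapping c) _ e))) (∧-elimʳ _ _ (∧-elimˡ (early c) _ e′)))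

    covers-plain : ∀ a → wrapping a ≡ false → Covers (𝓘 a) (match a)
    covers-plain a w = nonwrapping-covers (𝓘 a) (match a) w
      (first≤match a (rankIn plain a) firsts-below (≤-reflexive (sym (slot-plain a (cong not w)))))
      (match≤last a (begin
        h + suc (slot a)                                          ≡⟨ cong (λ s → h + suc s) (slot-plain a (cong not w)) ⟩
        h + suc (#early + rankIn plain a)                         ≡⟨ cong (h +_) (+-suc #early _) ⟨
        h + (#early + suc (rankIn plain a))                       ≡⟨ +-assoc h #early _ ⟨
        h + #early + suc (rankIn plain a)                         ≡⟨ cong (_+ suc (rankIn plain a)) #wrapping≡ ⟨
        #wrapping + suc (rankIn plain a)                          ≤⟨ +-monoʳ-≤ #wrapping (1+rankIn≤ plain a (cong not w)) ⟩
        #wrapping + firstsBelow plain (suc (firstOf a))           ≤⟨ count-disjoint _ wrapping _ wrapping-before plain-before wrapping≠plain ⟩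
        count (λ c → lastOf c <ᵇ suc (lastOf a))                  ∎))
      where
      open ≤-Reasoning
      firsts-below : northsQ (firstOf a) ≤ rankIn plain a
      firsts-below = ≤-trans (≤-reflexive (northsQ≡count (firstOf a) (<⇒≤ (firstOf<n a)))) (count-mono _ _ plain-below)
        where
        plain-below : ∀ c → (firstOf c <ᵇ firstOf a) ≡ true → (plain c ∧ (firstOf c <ᵇ firstOf a)) ≡ true
        plain-below c e with wrapping c in wc
        ... | true  = ⊥-elim (<-asym (<ᵇ-sound _ _ e) (nonwrapping-first<wrapping-first c a wc w))
        ... | false = e
      wrapping-before : ∀ c → wrapping c ≡ true → (lastOf c <ᵇ suc (lastOf a)) ≡ true
      wrapping-before c wc = <⇒<ᵇ-true _ _ (m<n⇒m<1+n (wrapping-last<nonwrapping-last c a wc w))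
      plain-before : ∀ c → (plain c ∧ (firstOf c <ᵇ suc (firstOf a))) ≡ true → (lastOf c <ᵇ suc (lastOf a)) ≡ true
      plain-before = last≤⇐first≤ a plain (λ c pc → nonwrapping-last-mono a c w (not-true⇒false pc))
      wrapping≠plain : ∀ c → wrapping c ≡ true → (plain c ∧ (firstOf c <ᵇ suc (firstOf a))) ≢ true
      wrapping≠plain c wc e = false≢true (trans (sym (cong not wc)) (∧-elimˡ _ _ e))

    covers-late : ∀ a → wrapping a ≡ true → (firstOf a <ᵇ τ) ≡ true → Covers (𝓘 a) (match a)
    covers-late a w f = wrapping-covers-tail (𝓘 a) (match a) (match<n a) w
      (first≤match a (#plain + rankIn late a) firsts-below
        (≤-reflexive (trans (sym (+-assoc #early #plain _)) (sym (slot-late a (∧-intro w f))))))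
      where
      plain-or-late : ∀ c → (firstOf c <ᵇ firstOf a) ≡ true → plain c ≡ true ⊎ (late c ∧ (firstOf c <ᵇ firstOf a)) ≡ true
      plain-or-late c e = by-wrapping (wrapping c) refl
        where
        by-wrapping : ∀ b → wrapping c ≡ b → plain c ≡ true ⊎ (late c ∧ (firstOf c <ᵇ firstOf a)) ≡ true
        by-wrapping false wc = inj₁ (cong not wc)
        by-wrapping true  wc = inj₂ (∧-intro (∧-intro wc (<⇒<ᵇ-true _ τ (<-trans (<ᵇ-sound _ _ e) (<ᵇ-sound _ τ f)))) e)
      firsts-below : northsQ (firstOf a) ≤ #plain + rankIn late a
      firsts-below = ≤-trans (≤-reflexive (northsQ≡count (firstOf a) (<⇒≤ (firstOf<n a)))) (count-∪ _ plain _ plain-or-late)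

    match-covers : ∀ a → Covers (𝓘 a) (match a)
    match-covers a = by-class (classify a)
      where
      by-class : Class a → Covers (𝓘 a) (match a)
      by-class (isEarly w f) = covers-early a w f
      by-class (isPlain w)   = covers-plain a w
      by-class (isLate w f)  = covers-late a w f

    matching : Matching X
    matching = record
      { match           = match
      ; match<n         = match<n
      ; match-covers    = match-covers
      ; match-injective = λ a b e → slot-injective a b (trans (sym (card<-match a)) (trans (cong (card< X) e) (card<-match b)))
      ; match-∈         = match-∈
      ; match-onto      = onto
      }
      where
      onto : ∀ j → memPos X j ≡ true → ∃[ a ] (match a ≡ j)
      onto j Xj =
        let rank<r = subst (card< X j <_) |X|≡r (≤-trans (≤-reflexive (sym (card<-suc-∈ X j Xj))) (norths-mono _ (memPos⇒< X j Xj)))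
            a , slot≡ = slot-onto (card< X j) rank<r
        in a , rank-injective X (match a) j (match-∈ a) Xj (trans (card<-match a) slot≡)

  between⇒independent : ∀ {X} → card< X n ≡ r → ∀ h → h ≤ #wrapping → Between h (card< X) → Independent X
  between⇒independent |X|≡r h h≤ between = matching⇒independent (Construction.matching |X|≡r h h≤ between)

  full-independent⇒basis : ∀ X → card< X n ≡ r → Independent X → Basis X
  full-independent⇒basis X |X|≡r ind = ind , maximal
    where
    maximal : ∀ Y → Independent Y → X ⊆ Y → Y ⊆ X
    maximal Y indY X⊆Y {y} y∈Y with memPos X (toℕ y) in Xy
    ... | true  = memPos⇒∈ X y Xy
    ... | false = ⊥-elim (<⇒≱ (subst (_< card< Y n) |X|≡r |X|<|Y|) (independent-size≤ indY))
      where
      |X|<|Y| : card< X n < card< Y n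
      |X|<|Y| = ≤-trans (≤-reflexive (cong suc (norths≡sumTo _ n)))
                  (≤-trans (sumTo-< _ _ n (toℕ y) (λ j _ → bit-mono _ _ (⊆⇒memPos X Y X⊆Y j)) (Fin.toℕ<n y)
                             (subst (λ b → bit b < bit (memPos Y (toℕ y))) (sym Xy) (subst (λ b → 0 < bit b) (sym (∈⇒memPos Y y∈Y)) (s≤s z≤n))))
                           (≤-reflexive (sym (norths≡sumTo _ n))))

  module _ (h : ℕ) where

    last-gap-below-Q : ∀ (X : Subset n) t → h + card< X t < #wrapping + northsQ t → card< X t < t →
                       ∃[ w ] (w < t × memPos X w ≡ false × (∀ t′ → w < t′ → t′ ≤ t → h + card< X t′ < #wrapping + northsQ t′))
    last-gap-below-Q X (suc t) below-Q |X∩t|<t = by-membership (memPos X t) refl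
      where
      Strict : ℕ → Set
      Strict t′ = h + card< X t′ < #wrapping + northsQ t′
      strict-below : memPos X t ≡ true → Strict t
      strict-below Xt = ≤-pred (begin
        suc (suc (h + card< X t))         ≡⟨ cong suc (+-suc h _) ⟨
        suc (h + suc (card< X t))         ≡⟨ cong (λ c → suc (h + c)) (card<-suc-∈ X t Xt) ⟨
        suc (h + card< X (suc t))         ≤⟨ below-Q ⟩
        #wrapping + northsQ (suc t)       ≤⟨ +-monoʳ-≤ #wrapping (norths-suc≤ wordQ t) ⟩
        #wrapping + suc (northsQ t)       ≡⟨ +-suc #wrapping _ ⟩
        suc (#wrapping + northsQ t)       ∎)
        where open ≤-Reasoning
      by-membership : ∀ b → memPos X t ≡ b → ∃[ w ] (w < suc t × memPos X w ≡ false × (∀ t′ → w < t′ → t′ ≤ suc t → Strict t′))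
      by-membership false Xt = t , ≤-refl , Xt , λ t′ t<t′ t′≤1+t → subst Strict (sym (≤-antisym t′≤1+t t<t′)) below-Q
      by-membership true Xt
        with w , w<t , Xw , strict ← last-gap-below-Q X t (strict-below Xt) (≤-pred (subst (_< suc t) (card<-suc-∈ X t Xt) |X∩t|<t))
        = w , m<n⇒m<1+n w<t , Xw , λ t′ w<t′ t′≤1+t → [ strict t′ w<t′ ∘′ ≤-pred , (λ { refl → below-Q }) ]′ (m≤n⇒m<n∨m≡n t′≤1+t)

    last-element-above-P : ∀ (X : Subset n) t → northsP t < h + card< X t → 0 < card< X t →
                           ∃[ w ] (w < t × memPos X w ≡ true × (∀ t′ → w < t′ → t′ ≤ t → northsP t′ < h + card< X t′))
    last-element-above-P X (suc t) above-P 0<|X∩t| = by-membership (memPos X t) refl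
      where
      Strict : ℕ → Set
      Strict t′ = northsP t′ < h + card< X t′
      strict-above : memPos X t ≡ false → Strict t
      strict-above Xt = ≤-<-trans (norths-mono wordP (n≤1+n t)) (subst (λ c → northsP (suc t) < h + c) (card<-suc-∉ X t Xt) above-P)
      by-membership : ∀ b → memPos X t ≡ b → ∃[ w ] (w < suc t × memPos X w ≡ true × (∀ t′ → w < t′ → t′ ≤ suc t → Strict t′))
      by-membership true Xt = t , ≤-refl , Xt , λ t′ t<t′ t′≤1+t → subst Strict (sym (≤-antisym t′≤1+t t<t′)) above-P
      by-membership false Xt
        with w , w<t , Xw , strict ← last-element-above-P X t (strict-above Xt) (subst (0 <_) (card<-suc-∉ X t Xt) 0<|X∩t|)
        = w , m<n⇒m<1+n w<t , Xw , λ t′ w<t′ t′≤1+t → [ strict t′ w<t′ ∘′ ≤-pred , (λ { refl → above-P }) ]′ (m≤n⇒m<n∨m≡n t′≤1+t)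

    insert-below-Q : h ≤ #wrapping → ∀ (X : Subset n) → Between h (card< X) → card< X n < r →
                     ∃[ w ] (memPos X (toℕ w) ≡ false × Between h (card< (X ∪ ⁅ w ⁆)))
    insert-below-Q h≤#wrapping X between |X|<r
      with w , w<n , Xw , strict ← last-gap-below-Q X n (+-mono-≤-< h≤#wrapping (subst (card< X n <_) (sym northsQ-end) |X|<r))
                                                     (<-≤-trans |X|<r (m≤n+m r m))
      = w′ , Xw′ , between′
      where
      w′ = Fin.fromℕ< w<n
      Xw′ : memPos X (toℕ w′) ≡ false
      Xw′ = trans (memPos-fromℕ< X w<n) Xw
      card<′ : ∀ t → card< (X ∪ ⁅ w′ ⁆) t ≡ card< X t + bit (w <ᵇ t)
      card<′ t = trans (card<-insert X w′ Xw′ t) (cong (λ z → card< X t + bit (z <ᵇ t)) (Fin.toℕ-fromℕ< w<n))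
      between′ : Between h (card< (X ∪ ⁅ w′ ⁆))
      between′ t t≤n with w <? t
      ... | yes w<t rewrite card<′ t | <⇒<ᵇ-true w t w<t =
        ≤-trans (proj₁ (between t t≤n)) (+-monoʳ-≤ h (m≤m+n _ 1)) ,
        ≤-trans (≤-reflexive (trans (sym (+-assoc h _ 1)) (+-comm _ 1))) (strict t w<t t≤n)
      ... | no w≮t rewrite card<′ t | ≮⇒<ᵇ-false w t w≮t | +-identityʳ (card< X t) = between t t≤n

    extend-below-Q : h ≤ #wrapping → ∀ d (X : Subset n) → card< X n + d ≡ r → Between h (card< X) →
                     Σ[ Y ∈ Subset n ] ((∀ j → memPos X j ≡ true → memPos Y j ≡ true) × card< Y n ≡ r × Between h (card< Y))
    extend-below-Q h≤ zero    X |X|+0≡r between = X , (λ j Xj → Xj) , trans (sym (+-identityʳ _)) |X|+0≡r , between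
    extend-below-Q h≤ (suc d) X |X|+d≡r between
      with w , Xw , between′ ← insert-below-Q h≤ X between (subst (card< X n <_) |X|+d≡r (m<m+n _ (s≤s z≤n)))
      with Y , X∪w⊆Y , |Y|≡r , betweenY ← extend-below-Q h≤ d (X ∪ ⁅ w ⁆)
                                             (trans (cong (_+ d) (card<-insert-all X w Xw)) (trans (+-assoc _ 1 d) |X|+d≡r)) between′
      = Y , (λ j Xj → X∪w⊆Y j (trans (memPos-∪ X ⁅ w ⁆ j) (cong (_∨ _) Xj))) , |Y|≡r , betweenY

  basis-size : ∀ {B} → Basis B → ∀ h → h ≤ #wrapping → Between h (card< B) → card< B n ≡ r
  basis-size {B} (indB , maximal) h h≤ between
    with Y , B⊆Y , |Y|≡r , betweenY ← extend-below-Q h h≤ (r ∸ card< B n) B (m+[n∸m]≡n (independent-size≤ indB)) between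
    = ≤-antisym (independent-size≤ indB) (subst (_≤ card< B n) |Y|≡r (card<-mono-⊆ Y B (⊆⇒memPos Y B Y⊆B) n))
    where
    Y⊆B : Y ⊆ B
    Y⊆B = maximal Y (between⇒independent |Y|≡r h h≤ betweenY) (λ {x} x∈B → memPos⇒∈ Y x (B⊆Y _ (∈⇒memPos B x∈B)))

  k∸1≡#wrapping : k ∸ 1 ≡ #wrapping
  k∸1≡#wrapping = cong (_∸ 1) k≡1+#wrapping

  P-onAntidiagonals : OnAntidiagonals #wrapping P
  P-onAntidiagonals t = trans (pathPt-onAntidiagonals (k ∸ 1) 0 wordP t) (cong (_+ t) (trans (+-identityʳ _) k∸1≡#wrapping))

  Q-onAntidiagonals : OnAntidiagonals #wrapping Q
  Q-onAntidiagonals t = trans (pathPt-onAntidiagonals (k ∸ k) (k ∸ 1) wordQ t)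
                              (trans (cong (λ x → x + (k ∸ 1) + t) (n∸n≡0 k)) (cong (_+ t) k∸1≡#wrapping))

  Q-height : ∀ t → proj₂ (Q t) ≡ #wrapping + northsQ t
  Q-height t = cong (_+ northsQ t) k∸1≡#wrapping

  module PathOf (B : Subset n) (h : ℕ) (h≤#wrapping : h ≤ #wrapping) where

    π : ℕ → Point
    π = Π B (p (suc h))

    π-onAntidiagonals : OnAntidiagonals #wrapping π
    π-onAntidiagonals t = trans (pathPt-onAntidiagonals (k ∸ suc h) h (wordOf B) t) (cong (_+ t) start-on-L)
      where
      start-on-L : k ∸ suc h + h ≡ #wrapping
      start-on-L = trans (cong (λ x → x ∸ suc h + h) k≡1+#wrapping) (m∸n+n≡m h≤#wrapping)

    valid⇒between : Valid π → Between h (card< B)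
    valid⇒between valid t t≤n with valid t t≤n
    ... | t′ , _ , on-t′ , above-P , below-Q
      with refl ← +-cancelˡ-≡ #wrapping t t′ (trans (sym (π-onAntidiagonals t)) (trans on-t′ (cong (_+ t′) k∸1≡#wrapping)))
      = above-P , subst (h + card< B t ≤_) (Q-height t) below-Q

    touches⇔ : ∀ {ρ} → OnAntidiagonals #wrapping ρ → ∀ u →
               TouchesAfter π u ρ ⇔ (∃[ t ] (u ≤ t × t ≤ n × h + card< B t ≡ proj₂ (ρ t)))
    touches⇔ {ρ} ρ-diag u = mk⇔
      (λ (t , u≤t , t≤n , s , _ , e) → let s≡t , heights = points-≡ π ρ π-onAntidiagonals ρ-diag t s e
                                      in t , u≤t , t≤n , trans heights (cong (λ z → proj₂ (ρ z)) (sym s≡t)))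
      (λ (t , u≤t , t≤n , e) → t , u≤t , t≤n , t , t≤n , points-≡⇐ π ρ π-onAntidiagonals ρ-diag t e)

    stepIn⇔ : ∀ {ρ} → OnAntidiagonals #wrapping ρ → ∀ q → q < n →
              StepIn π (suc q) ρ ⇔ (h + card< B q ≡ proj₂ (ρ q) × h + card< B (suc q) ≡ proj₂ (ρ (suc q)))
    stepIn⇔ {ρ} ρ-diag q q<n = mk⇔
      (λ (s , _ , _ , e₁ , e₂) → case-step s e₁ e₂)
      (λ (e₁ , e₂) → suc q , s≤s z≤n , q<n , points-≡⇐ π ρ π-onAntidiagonals ρ-diag q e₁ , points-≡⇐ π ρ π-onAntidiagonals ρ-diag (suc q) e₂)
      where
      case-step : ∀ s → π q ≡ ρ (s ∸ 1) → π (suc q) ≡ ρ s → h + card< B q ≡ proj₂ (ρ q) × h + card< B (suc q) ≡ proj₂ (ρ (suc q))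
      case-step s e₁ e₂ with refl ← proj₁ (points-≡ π ρ π-onAntidiagonals ρ-diag (suc q) s e₂) = cong proj₂ e₁ , cong proj₂ e₂

  Bounds : ℕ → ℕ → ℕ → Set
  Bounds h c t = northsP t ≤ h + c × h + c ≤ #wrapping + northsQ t

  module Activity (B : Subset n) (basis : Basis B) (h : ℕ) (h≤#wrapping : h ≤ #wrapping)
                  (valid : Valid (PathOf.π B h h≤#wrapping)) where
    open PathOf B h h≤#wrapping public

    b : ℕ → ℕ
    b = card< B

    between : Between h b
    between = valid⇒between valid

    |B|≡r : b n ≡ r
    |B|≡r = basis-size basis h h≤#wrapping between

    module Exchanged (x y : Fin n) (Bx : memPos B (toℕ x) ≡ true) (By : memPos B (toℕ y) ≡ false) where
      open Exchange B x y Bx By public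

      exchanged-size : card< exchanged n ≡ r
      exchanged-size = trans (card<-after-both n (Fin.toℕ<n x) (Fin.toℕ<n y)) |B|≡r

      between⇒basis : ∀ h′ → h′ ≤ #wrapping → Between h′ (card< exchanged) → Basis exchanged
      between⇒basis h′ h′≤ between′ =
        full-independent⇒basis exchanged exchanged-size (between⇒independent exchanged-size h′ h′≤ between′)

      basis⇒between : Basis exchanged → ∃[ h′ ] (h′ ≤ #wrapping × Between h′ (card< exchanged))
      basis⇒between (ind , _) =
        let μ = independent⇒matching ind exchanged-size in count (matchedLate μ) , matchedLate≤#wrapping μ , matching⇒between μ

      between-raised : ∀ h′ → toℕ y < toℕ x →
        (∀ t → t ≤ n → t ≤ toℕ y → Bounds h′ (b t) t) → (∀ t → t ≤ n → toℕ y < t → t ≤ toℕ x → Bounds h′ (suc (b t)) t) →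
        (∀ t → t ≤ n → toℕ x < t → Bounds h′ (b t) t) → Between h′ (card< exchanged)
      between-raised h′ y<x before inside after t t≤n with toℕ y <? t | toℕ x <? t
      ... | no y≮t | _       rewrite card<-before-both t (λ x<t → y≮t (<-trans y<x x<t)) y≮t = before t t≤n (≮⇒≥ y≮t)
      ... | yes y<t | no x≮t rewrite card<-gains t x≮t y<t = inside t t≤n y<t (≮⇒≥ x≮t)
      ... | yes y<t | yes x<t rewrite card<-after-both t x<t y<t = after t t≤n x<t

      between-lowered : ∀ h′ → toℕ x < toℕ y →
        (∀ t → t ≤ n → t ≤ toℕ x → Bounds h′ (b t) t) → (∀ t → t ≤ n → toℕ x < t → t ≤ toℕ y → ∀ c → suc c ≡ b t → Bounds h′ c t) →
        (∀ t → t ≤ n → toℕ y < t → Bounds h′ (b t) t) → Between h′ (card< exchanged)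
      between-lowered h′ x<y before inside after t t≤n with toℕ x <? t | toℕ y <? t
      ... | no x≮t | _       rewrite card<-before-both t x≮t (λ y<t → x≮t (<-trans x<y y<t)) = before t t≤n (≮⇒≥ x≮t)
      ... | yes x<t | no y≮t = inside t t≤n x<t (≮⇒≥ y≮t) _ (card<-loses t x<t y≮t)
      ... | yes x<t | yes y<t rewrite card<-after-both t x<t y<t = after t t≤n y<t

    on-P⇔ : ∀ u → TouchesAfter π u P ⇔ (∃[ t ] (u ≤ t × t ≤ n × h + b t ≡ northsP t))
    on-P⇔ = touches⇔ P-onAntidiagonals

    module Internal (u : Fin n) (u∈B : u ∈ B) where
      q : ℕ
      q = toℕ u

      q<n : q < n
      q<n = Fin.toℕ<n u

      Bu : memPos B q ≡ true
      Bu = ∈⇒memPos B u∈B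

      Criterion : Set
      Criterion = (∀ (v : Fin n) → v Fin.≤ u → v ∈ B) ⊎ (StepIn π (suc q) Q × TouchesAfter π (suc q) P)

      Witness : Set
      Witness = ∃[ v ] (v ∉ B × v Fin.< u × Basis ((B - u) ∪ ⁅ v ⁆))

      active⇐ : Criterion → ¬ Witness
      active⇐ (inj₁ all) (v , v∉B , v<u , _) = v∉B (all v (<⇒≤ v<u))
      active⇐ (inj₂ (step , touch)) (v , v∉B , v<u , basis′) =
        unraisable v (∉⇒memPos B v∉B) v<u (Exchanged.basis⇒between u v Bu (∉⇒memPos B v∉B) basis′)
                   (Equivalence.to (on-P⇔ (suc q)) touch)
        where
        on-Q : h + b q ≡ #wrapping + northsQ q
        on-Q = trans (proj₁ (Equivalence.to (stepIn⇔ Q-onAntidiagonals q q<n) step)) (Q-height q)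
        unraisable : ∀ v Bv → v Fin.< u → let open Exchanged u v Bu Bv in
                     ∃[ h′ ] (h′ ≤ #wrapping × Between h′ (card< exchanged)) →
                     ∃[ t₀ ] (suc q ≤ t₀ × t₀ ≤ n × h + b t₀ ≡ northsP t₀) → ⊥
        unraisable v Bv v<u (h′ , _ , between′) (t₀ , q<t₀ , t₀≤n , touches-P) = <-irrefl refl (<-≤-trans h′<h h≤h′)
          where
          open Exchanged u v Bu Bv
          open ≤-Reasoning
          h′<h : h′ < h
          h′<h = +-cancelʳ-≤ (b q) (suc h′) h (begin
            suc h′ + b q            ≡⟨ +-suc h′ (b q) ⟨
            h′ + suc (b q)          ≡⟨ cong (h′ +_) (card<-gains q (<-irrefl refl) v<u) ⟨
            h′ + card< exchanged q  ≤⟨ proj₂ (between′ q (<⇒≤ q<n)) ⟩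
            #wrapping + northsQ q   ≡⟨ on-Q ⟨
            h + b q                 ∎)
          h≤h′ : h ≤ h′
          h≤h′ = +-cancelʳ-≤ (b t₀) h h′ (begin
            h + b t₀                 ≡⟨ touches-P ⟩
            northsP t₀               ≤⟨ proj₁ (between′ t₀ t₀≤n) ⟩
            h′ + card< exchanged t₀  ≡⟨ cong (h′ +_) (card<-after-both t₀ q<t₀ (<-trans v<u q<t₀)) ⟩
            h′ + b t₀                ∎)

      -- If the path at u lies strictly below Q, a final segment ending at u can be raised.
      raise-segment : ∀ j₀ → j₀ < q → memPos B j₀ ≡ false → h + b q < #wrapping + northsQ q → Witness
      raise-segment j₀ j₀<q Bj₀ below-Q
        with w , w<q , Bw , strict ← last-gap-below-Q h B q below-Q (card<-gap B q j₀ j₀<q Bj₀)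
        = v , (λ v∈B → false≢true (trans (sym Bv) (∈⇒memPos B v∈B))) , v<u
        , between⇒basis h h≤#wrapping (between-raised h v<u (λ t t≤n _ → between t t≤n) inside (λ t t≤n _ → between t t≤n))
        where
        w<n = <-trans w<q q<n
        v = Fin.fromℕ< w<n
        toℕv≡w : toℕ v ≡ w
        toℕv≡w = Fin.toℕ-fromℕ< w<n
        Bv : memPos B (toℕ v) ≡ false
        Bv = trans (cong (memPos B) toℕv≡w) Bw
        v<u : v Fin.< u
        v<u = subst (_< q) (sym toℕv≡w) w<q
        open Exchanged u v Bu Bv
        inside : ∀ t → t ≤ n → toℕ v < t → t ≤ q → Bounds h (suc (b t)) t
        inside t t≤n v<t t≤q = ≤-trans (proj₁ (between t t≤n)) (+-monoʳ-≤ h (n≤1+n _))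
                             , subst (_≤ #wrapping + northsQ t) (sym (+-suc h (b t))) (strict t (subst (_< t) toℕv≡w v<t) t≤q)

      -- If the path never touches P after u, it can start one step lower and be raised up to u from the first non-element.
      lower-start : ∀ j₀ → j₀ < q → memPos B j₀ ≡ false → (∀ j → j < j₀ → memPos B j ≡ true) →
                    (∀ t → suc q ≤ t → t ≤ n → h + b t ≢ northsP t) → Witness
      lower-start j₀ j₀<q Bj₀ before-j₀ no-touch =
        v , (λ v∈B → false≢true (trans (sym Bv) (∈⇒memPos B v∈B))) , v<u
        , between⇒basis h′ (≤-trans (m∸n≤m h 1) h≤#wrapping) (between-raised h′ v<u before inside after)
        where
        above-P : ∀ t → suc q ≤ t → t ≤ n → northsP t < h + b t
        above-P t q<t t≤n = ≤∧≢⇒< (proj₁ (between t t≤n)) (no-touch t q<t t≤n ∘′ sym)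
        h≢0 : h ≢ 0
        h≢0 refl = <-irrefl (trans northsP-end (sym |B|≡r)) (above-P n q<n ≤-refl)
        h′ = h ∸ 1
        1+h′≡h : suc h′ ≡ h
        1+h′≡h = m+[n∸m]≡n (n≢0⇒n>0 h≢0)
        j₀<n = <-trans j₀<q q<n
        v = Fin.fromℕ< j₀<n
        toℕv≡j₀ : toℕ v ≡ j₀
        toℕv≡j₀ = Fin.toℕ-fromℕ< j₀<n
        Bv : memPos B (toℕ v) ≡ false
        Bv = trans (cong (memPos B) toℕv≡j₀) Bj₀
        v<u : v Fin.< u
        v<u = subst (_< q) (sym toℕv≡j₀) j₀<q
        open Exchanged u v Bu Bv
        h′+≤h+ : ∀ c → h′ + c ≤ h + c
        h′+≤h+ c = +-monoˡ-≤ c (m∸n≤m h 1)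
        before : ∀ t → t ≤ n → t ≤ toℕ v → Bounds h′ (b t) t
        before t t≤n t≤v = ≤-trans (norths≤ wordP t) (≤-trans (≤-reflexive (sym b≡t)) (m≤n+m _ h′))
                         , ≤-trans (h′+≤h+ (b t)) (proj₂ (between t t≤n))
          where
          b≡t : b t ≡ t
          b≡t = card<-full B t (λ j j<t → before-j₀ j (<-≤-trans j<t (subst (t ≤_) toℕv≡j₀ t≤v)))
        inside : ∀ t → t ≤ n → toℕ v < t → t ≤ q → Bounds h′ (suc (b t)) t
        inside t t≤n _ _ = subst (λ c → northsP t ≤ c × c ≤ #wrapping + northsQ t)
                                 (trans (cong (_+ b t) (sym 1+h′≡h)) (sym (+-suc h′ (b t)))) (between t t≤n)
        after : ∀ t → t ≤ n → q < t → Bounds h′ (b t) t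
        after t t≤n q<t = ≤-pred (subst (northsP t <_) (cong (_+ b t) (sym 1+h′≡h)) (above-P t q<t t≤n))
                        , ≤-trans (h′+≤h+ (b t)) (proj₂ (between t t≤n))

      on-Q-at-u⇒after : h + b q ≡ #wrapping + northsQ q → h + b (suc q) ≡ #wrapping + northsQ (suc q)
      on-Q-at-u⇒after on-Q = ≤-antisym (proj₂ (between (suc q) q<n)) (begin
        #wrapping + northsQ (suc q)  ≤⟨ +-monoʳ-≤ #wrapping (norths-suc≤ wordQ q) ⟩
        #wrapping + suc (northsQ q)  ≡⟨ +-suc #wrapping _ ⟩
        suc (#wrapping + northsQ q)  ≡⟨ cong suc on-Q ⟨
        suc (h + b q)                ≡⟨ +-suc h (b q) ⟨
        h + suc (b q)                ≡⟨ cong (h +_) (card<-suc-∈ B q Bu) ⟨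
        h + b (suc q)                ∎)
        where open ≤-Reasoning

      active⇒ : ¬ Witness → Criterion
      active⇒ active with firstFailure (memPos B) (suc q)
      ... | inj₁ all = inj₁ (λ v v≤u → memPos⇒∈ B v (all (toℕ v) (s≤s v≤u)))
      ... | inj₂ (j₀ , j₀≤q , Bj₀ , before-j₀) =
        from-first-gap j₀ (≤∧≢⇒< (≤-pred j₀≤q) (λ { refl → false≢true (trans (sym Bj₀) Bu) })) Bj₀ before-j₀
        where
        from-first-gap : ∀ j₀ → j₀ < q → memPos B j₀ ≡ false → (∀ j → j < j₀ → memPos B j ≡ true) → Criterion
        from-first-gap j₀ j₀<q Bj₀ before-j₀ with h + b q ≟ #wrapping + northsQ q
        ... | no off-Q = ⊥-elim (active (raise-segment j₀ j₀<q Bj₀ (≤∧≢⇒< (proj₂ (between q (<⇒≤ q<n))) off-Q)))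
        ... | yes on-Q with search (λ t → h + b t ≡ northsP t) (λ t → h + b t ≟ northsP t) (suc q) n
        ...   | inj₁ touch    = inj₂ ( Equivalence.from (stepIn⇔ Q-onAntidiagonals q q<n)
                                         (trans on-Q (sym (Q-height q)) , trans (on-Q-at-u⇒after on-Q) (sym (Q-height (suc q))))
                                     , Equivalence.from (on-P⇔ (suc q)) touch)
        ...   | inj₂ no-touch = ⊥-elim (active (lower-start j₀ j₀<q Bj₀ before-j₀ no-touch))

      internally-active⇔ : InternallyActive B u ⇔ Criterion
      internally-active⇔ = mk⇔ active⇒ active⇐

    module External (u : Fin n) (u∉B : u ∉ B) where
      q : ℕ
      q = toℕ u

      q<n : q < n
      q<n = Fin.toℕ<n u

      Bu : memPos B q ≡ false
      Bu = ∉⇒memPos B u∉B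

      Criterion : Set
      Criterion = (∀ (v : Fin n) → v Fin.≤ u → v ∉ B) ⊎ (StepIn π (suc q) P × TouchesAfter π (suc q) Q)

      Witness : Set
      Witness = ∃[ v ] (v ∈ B × v Fin.< u × Basis ((B - v) ∪ ⁅ u ⁆))

      touch-Q : ∃[ t ] (suc q ≤ t × t ≤ n × h + b t ≡ #wrapping + northsQ t) → TouchesAfter π (suc q) Q
      touch-Q (t , q<t , t≤n , e) = Equivalence.from (touches⇔ Q-onAntidiagonals (suc q)) (t , q<t , t≤n , trans e (sym (Q-height t)))

      active⇐ : Criterion → ¬ Witness
      active⇐ (inj₁ none) (v , v∈B , v<u , _) = none v (<⇒≤ v<u) v∈B
      active⇐ (inj₂ (step , touch)) (v , v∈B , v<u , basis′) =
        unlowerable v (∈⇒memPos B v∈B) v<u (Exchanged.basis⇒between v u (∈⇒memPos B v∈B) Bu basis′)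
                    (Equivalence.to (touches⇔ Q-onAntidiagonals (suc q)) touch)
        where
        on-P : h + b q ≡ northsP q
        on-P = proj₁ (Equivalence.to (stepIn⇔ P-onAntidiagonals q q<n) step)
        unlowerable : ∀ v Bv → v Fin.< u → let open Exchanged v u Bv Bu in
                      ∃[ h′ ] (h′ ≤ #wrapping × Between h′ (card< exchanged)) →
                      ∃[ t₀ ] (suc q ≤ t₀ × t₀ ≤ n × h + b t₀ ≡ proj₂ (Q t₀)) → ⊥
        unlowerable v Bv v<u (h′ , _ , between′) (t₀ , q<t₀ , t₀≤n , touches-Q) = <-irrefl refl (<-≤-trans h<h′ h′≤h)
          where
          open Exchanged v u Bv Bu
          open ≤-Reasoning
          h<h′ : h < h′
          h<h′ = +-cancelʳ-≤ (card< exchanged q) (suc h) h′ (begin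
            suc h + card< exchanged q    ≡⟨ +-suc h _ ⟨
            h + suc (card< exchanged q)  ≡⟨ cong (h +_) (card<-loses q v<u (<-irrefl refl)) ⟩
            h + b q                      ≡⟨ on-P ⟩
            northsP q                    ≤⟨ proj₁ (between′ q (<⇒≤ q<n)) ⟩
            h′ + card< exchanged q       ∎)
          h′≤h : h′ ≤ h
          h′≤h = +-cancelʳ-≤ (b t₀) h′ h (begin
            h′ + b t₀                ≡⟨ cong (h′ +_) (card<-after-both t₀ (<-trans v<u q<t₀) q<t₀) ⟨
            h′ + card< exchanged t₀  ≤⟨ proj₂ (between′ t₀ t₀≤n) ⟩
            #wrapping + northsQ t₀   ≡⟨ Q-height t₀ ⟨
            proj₂ (Q t₀)             ≡⟨ touches-Q ⟨
            h + b t₀                 ∎)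

      -- If the path at u lies strictly above P, a final segment ending at u can be lowered.
      lower-segment : ∀ j₀ → j₀ < q → memPos B j₀ ≡ true → northsP q < h + b q → Witness
      lower-segment j₀ j₀<q Bj₀ above-P
        with w , w<q , Bw , strict ← last-element-above-P h B q above-P
                                       (≤-trans (s≤s z≤n) (≤-trans (≤-reflexive (sym (card<-suc-∈ B j₀ Bj₀))) (norths-mono _ j₀<q)))
        = v , memPos⇒∈ B v Bv , v<u
        , between⇒basis h h≤#wrapping (between-lowered h v<u (λ t t≤n _ → between t t≤n) inside (λ t t≤n _ → between t t≤n))
        where
        w<n = <-trans w<q q<n
        v = Fin.fromℕ< w<n
        toℕv≡w : toℕ v ≡ w
        toℕv≡w = Fin.toℕ-fromℕ< w<n
        Bv : memPos B (toℕ v) ≡ true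
        Bv = trans (cong (memPos B) toℕv≡w) Bw
        v<u : v Fin.< u
        v<u = subst (_< q) (sym toℕv≡w) w<q
        open Exchanged v u Bv Bu
        inside : ∀ t → t ≤ n → toℕ v < t → t ≤ q → ∀ c → suc c ≡ b t → Bounds h c t
        inside t t≤n v<t t≤q c 1+c≡b =
            ≤-pred (subst (northsP t <_) (trans (cong (h +_) (sym 1+c≡b)) (+-suc h c)) (strict t (subst (_< t) toℕv≡w v<t) t≤q))
          , ≤-trans (+-monoʳ-≤ h (≤-trans (n≤1+n c) (≤-reflexive 1+c≡b))) (proj₂ (between t t≤n))

      -- If the path never touches Q after u, it can start one step higher and be lowered up to u from the first element.
      raise-start : ∀ j₀ → j₀ < q → memPos B j₀ ≡ true → (∀ j → j < j₀ → memPos B j ≡ false) →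
                    (∀ t → suc q ≤ t → t ≤ n → h + b t ≢ #wrapping + northsQ t) → Witness
      raise-start j₀ j₀<q Bj₀ before-j₀ no-touch =
        v , memPos⇒∈ B v Bv , v<u , between⇒basis (suc h) 1+h≤#wrapping (between-lowered (suc h) v<u before inside after)
        where
        below-Q : ∀ t → suc q ≤ t → t ≤ n → h + b t < #wrapping + northsQ t
        below-Q t q<t t≤n = ≤∧≢⇒< (proj₂ (between t t≤n)) (no-touch t q<t t≤n)
        1+h≤#wrapping : suc h ≤ #wrapping
        1+h≤#wrapping = +-cancelʳ-≤ r (suc h) #wrapping
          (subst₂ (λ c d → suc h + c ≤ #wrapping + d) |B|≡r northsQ-end (below-Q n q<n ≤-refl))
        j₀<n = <-trans j₀<q q<n
        v = Fin.fromℕ< j₀<n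
        toℕv≡j₀ : toℕ v ≡ j₀
        toℕv≡j₀ = Fin.toℕ-fromℕ< j₀<n
        Bv : memPos B (toℕ v) ≡ true
        Bv = trans (cong (memPos B) toℕv≡j₀) Bj₀
        v<u : v Fin.< u
        v<u = subst (_< q) (sym toℕv≡j₀) j₀<q
        open Exchanged v u Bv Bu
        before : ∀ t → t ≤ n → t ≤ toℕ v → Bounds (suc h) (b t) t
        before t t≤n t≤v = ≤-trans (proj₁ (between t t≤n)) (n≤1+n _)
                         , ≤-trans (≤-reflexive (trans (cong (suc h +_) b≡0) (+-identityʳ _))) (≤-trans 1+h≤#wrapping (m≤m+n _ _))
          where
          b≡0 : b t ≡ 0
          b≡0 = card<-empty B t (λ j j<t → before-j₀ j (<-≤-trans j<t (subst (t ≤_) toℕv≡j₀ t≤v)))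
        inside : ∀ t → t ≤ n → toℕ v < t → t ≤ q → ∀ c → suc c ≡ b t → Bounds (suc h) c t
        inside t t≤n _ _ c 1+c≡b = subst (λ d → northsP t ≤ d × d ≤ #wrapping + northsQ t)
                                         (trans (cong (h +_) (sym 1+c≡b)) (+-suc h c)) (between t t≤n)
        after : ∀ t → t ≤ n → q < t → Bounds (suc h) (b t) t
        after t t≤n q<t = ≤-trans (proj₁ (between t t≤n)) (n≤1+n _) , below-Q t q<t t≤n

      on-P-at-u⇒after : h + b q ≡ northsP q → h + b (suc q) ≡ northsP (suc q)
      on-P-at-u⇒after on-P = ≤-antisym
        (≤-trans (≤-reflexive (trans (cong (h +_) (card<-suc-∉ B q Bu)) on-P)) (norths-mono wordP (n≤1+n q)))
        (proj₁ (between (suc q) q<n))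

      active⇒ : ¬ Witness → Criterion
      active⇒ active with firstFailure (λ j → not (memPos B j)) (suc q)
      ... | inj₁ none = inj₁ (λ v v≤u v∈B → false≢true (trans (sym (not-true⇒false (none (toℕ v) (s≤s v≤u)))) (∈⇒memPos B v∈B)))
      ... | inj₂ (j₀ , j₀≤q , ¬Bj₀ , before-j₀) =
        from-first-element j₀ (≤∧≢⇒< (≤-pred j₀≤q) (λ { refl → false≢true (trans (sym Bu) Bj₀) })) Bj₀
                           (λ j j<j₀ → not-true⇒false (before-j₀ j j<j₀))
        where
        Bj₀ = not-false⇒true ¬Bj₀
        from-first-element : ∀ j₀ → j₀ < q → memPos B j₀ ≡ true → (∀ j → j < j₀ → memPos B j ≡ false) → Criterion
        from-first-element j₀ j₀<q Bj₀ before-j₀ with h + b q ≟ northsP q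
        ... | no off-P = ⊥-elim (active (lower-segment j₀ j₀<q Bj₀ (≤∧≢⇒< (proj₁ (between q (<⇒≤ q<n))) (off-P ∘′ sym))))
        ... | yes on-P with search (λ t → h + b t ≡ #wrapping + northsQ t) (λ t → h + b t ≟ #wrapping + northsQ t) (suc q) n
        ...   | inj₁ touch    = inj₂ (Equivalence.from (stepIn⇔ P-onAntidiagonals q q<n) (on-P , on-P-at-u⇒after on-P) , touch-Q touch)
        ...   | inj₂ no-touch = ⊥-elim (active (raise-start j₀ j₀<q Bj₀ before-j₀ no-touch))

      externally-active⇔ : ExternallyActive B u ⇔ Criterion
      externally-active⇔ = mk⇔ active⇒ active⇐

theorem5p3 : (m r : ℕ) (𝓘 : Fin r → Interval (m + r))
    → Setup.Antichain m r 𝓘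
    → (B : Subset (m + r)) → Setup.Basis m r 𝓘 B
    → (i : ℕ) → 1 ≤ i → i ≤ Setup.k m r 𝓘
    → Setup.Valid m r 𝓘 (Setup.Π m r 𝓘 B (Setup.p m r 𝓘 i))
    → ((u : Fin (m + r)) → u ∈ B →
         Setup.InternallyActive m r 𝓘 B u
         ⇔ ((∀ (v : Fin (m + r)) → v Fin.≤ u → v ∈ B)
            ⊎ (Setup.StepIn m r 𝓘 (Setup.Π m r 𝓘 B (Setup.p m r 𝓘 i)) (suc (toℕ u)) (Setup.Q m r 𝓘)
               Data.Product.× Setup.TouchesAfter m r 𝓘 (Setup.Π m r 𝓘 B (Setup.p m r 𝓘 i)) (suc (toℕ u)) (Setup.P m r 𝓘))))
    Data.Product.× ((u : Fin (m + r)) → u ∉ B →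
         Setup.ExternallyActive m r 𝓘 B u
         ⇔ ((∀ (v : Fin (m + r)) → v Fin.≤ u → v ∉ B)
            ⊎ (Setup.StepIn m r 𝓘 (Setup.Π m r 𝓘 B (Setup.p m r 𝓘 i)) (suc (toℕ u)) (Setup.P m r 𝓘)
               Data.Product.× Setup.TouchesAfter m r 𝓘 (Setup.Π m r 𝓘 B (Setup.p m r 𝓘 i)) (suc (toℕ u)) (Setup.Q m r 𝓘))))
theorem5p3 m r 𝓘 antichain B basis (suc h) (s≤s z≤n) 1+h≤k valid =
  Internal.internally-active⇔ , External.externally-active⇔
  where
  open Presentation m r 𝓘 antichain
  h≤#wrapping : h ≤ #wrapping
  h≤#wrapping = subst (h ≤_) k∸1≡#wrapping (∸-monoˡ-≤ 1 1+h≤k)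
  open Activity B basis h h≤#wrapping valid
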